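{- Let QHC+H be the logic obtained by adding to the derivation system of QHC the H-principle $\cdot\,?(\gamma\lor\neg\gamma)$. Then QHC+H is a conservative extension of QS5, where QS5 formulas are identified with c-formulas by reading $\Box$ as $?!$ and predicate variables as proper predicate variables. That is, for every rule or principle $R$ whose formulas are QS5 formulas, $\vdash_{QHC+H}R$ holds if and only if $\vdash_{QS5}R$.
   Context: Meta-logical framework. Formulas of a first-order language may contain individual variables and predicate variables. Meta-formulas are built from formulas using meta-conjunction $\&$, meta-implication $\Rightarrow$, and universal meta-quantifiers over individual and predicate variables. A principle $\cdot G$, for a formula $G$, is the meta-formula obtained by universally meta-quantifying all free individual variables of $G$ and then all predicate variables of $G$. A rule $F_1,\dots,F_m/G$ is the meta-formula $\forall^2(\forall^1F_1\,\&\cdots\&\,\forall^1F_m\Rightarrow\forall^1G)$, where $\forall^1$ meta-quantifies the free individual variables of the formula it precedes and $\forall^2$ meta-quantifies all predicate variables occurring. A logic $L$ is given by a derivation system $\mathcal D$, a meta-conjunction of finitely many principles and rules. For a meta-formula $\mathcal F$, $\vdash_L\mathcal F$ means that $\mathcal D\Rightarrow\mathcal F$ is derivable by the natural-deduction meta-rules: introduction and elimination of $\&$, $\Rightarrow$ and the universal meta-quantifiers (elimination allows substituting terms for individual variables and formulas for predicate variables), plus $\alpha$-conversion. Language of QHC. It has individual variables and, for each $n\ge0$, countably many $n$-ary problem variables $\alpha,\beta,\gamma,\delta,\theta,\dots$ and countably many $n$-ary proper predicate variables $p,q,\dots$. - A c-formula is $\top$, $\bot$, an atom $p(x_1,\dots,x_n)$,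 or $?\Phi$ for an i-formula $\Phi$, closed under the classical connectives $\land,\lor,\to,\leftrightarrow,\neg$ and quantifiers $\exists,\forall$. - An i-formula is $\checkmark$ (triviality), $\curlywedge$ (absurdity), an atom $\alpha(x_1,\dots,x_n)$, or $!F$ for a c-formula $F$, closed under the intuitionistic connectives $\land,\lor,\to,\leftrightarrow,\neg$ (with $\neg\Phi:=\Phi\to\curlywedge$) and quantifiers $\exists,\forall$. Connectives applied to c-formulas are classical; those applied to i-formulas are intuitionistic. QHC is the logic whose derivation system consists of: - (0a) all laws and rules of classical predicate logic QC, for c-formulas; - (0b) all laws and rules of intuitionistic predicate logic QH, for i-formulas; - the principles $\cdot\,?(\gamma\land\delta)\leftrightarrow ?\gamma\land ?\delta$, $\cdot\,?(\gamma\lor\delta)\leftrightarrow ?\gamma\lor ?\delta$, $\cdot\,?(\gamma\to\delta)\to(?\gamma\to ?\delta)$, $\cdot\,\neg ?\curlywedge$, $\cdot\,?\exists x\,\theta(x)\leftrightarrow\exists x\,?\theta(x)$, $\cdot\,?\forall x\,\theta(x)\to\forall x\,?\theta(x)$, $\cdot\,\gamma\to\,!?\gamma$, $\cdot\,\neg !\bot$, $\cdot\,?!p\to p$, $\cdot\,!p\to\,!?!p$ and $\cdot\,!(p\to q)\to(!p\to !q)$; - the rules $!p/p$ and $p/!p$. QS4 is the extension of QC by a modal operator $\Box$ with the laws $\cdot\,\Box p\to p$, $\cdot\,\Box p\to\Box\Box p$ and $\cdot\,\Box(p\to q)\to(\Box p\to\Box q)$, and the rule $p/\Box p$. QS5 is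 QS4 plus the law $\cdot\,\Diamond p\to\Box\Diamond p$, where $\Diamond:=\neg\Box\neg$. -}

module Defs where

open import Data.Nat using (ℕ; zero; suc; _+_)
open import Data.Fin using (Fin; zero; suc; _↑ˡ_; splitAt)
open import Data.Vec using (Vec; []; _∷_; lookup; tabulate) renaming (map to vmap)
open import Data.List using (List; []; _∷_) renaming (map to lmap)
open import Data.Product using (_×_; _,_; proj₁; proj₂)
open import Data.Sum using ([_,_])
open import Function using (_∘_; id)

infix 4 _∋_
data _∋_ {A : Set} : List A → A → Set where
  here  : ∀ {x xs} → (x ∷ xs) ∋ x
  there : ∀ {x y xs} → xs ∋ x → (y ∷ xs) ∋ x

liftF : ∀ {n m} → (Fin n → Fin m) → Fin (suc n) → Fin (suc m)
liftF ρ zero    = zero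
liftF ρ (suc i) = suc (ρ i)

liftV : ∀ {A : Set} {Δ Δ' : List A} {y : A} →
        (∀ {κ} → Δ ∋ κ → Δ' ∋ κ) → ∀ {κ} → (y ∷ Δ) ∋ κ → (y ∷ Δ') ∋ κ
liftV ρ here      = here
liftV ρ (there x) = there (ρ x)

-- An object language: formulas of a sort s, over a context Δ of
-- predicate variables (each with a sort and an arity) and n free
-- individual variables (de Bruijn).  Terms are individual variables only.
-- The operations are: renaming of individual variables, renaming of
-- predicate variables, atoms, and (capture-avoiding) simultaneous
-- substitution of formulas for predicate variables: a predicate
-- variable κ of arity k is replaced by a formula in scope (k + n) whose
-- k lowest variables are the argument places and whose remaining n
-- variables are parameters, mapped into the current scope by θ.
record Syntax : Set₁ where
  field
    Sort  : Set
    Fm    : Sort → List (Sort × ℕ) → ℕ → Set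
    ren   : ∀ {s Δ n m} → (Fin n → Fin m) → Fm s Δ n → Fm s Δ m
    pren  : ∀ {s Δ Δ' n} → (∀ {κ} → Δ ∋ κ → Δ' ∋ κ) → Fm s Δ n → Fm s Δ' n
    patom : ∀ {Δ n κ} → Δ ∋ κ → Vec (Fin n) (proj₂ κ) → Fm (proj₁ κ) Δ n
    psub  : ∀ {s Δ Δ' n n'} →
            (∀ {κ} → Δ ∋ κ → Fm (proj₁ κ) Δ' (proj₂ κ + n)) →
            (Fin n → Fin n') → Fm s Δ n' → Fm s Δ' n'

module Framework (L : Syntax) where
  open Syntax L

  Ctx : Set
  Ctx = List (Sort × ℕ)

  infixr 6 _&_
  infixr 5 _⇛_

  data MF : Ctx → ℕ → Set where
    fml : ∀ {s Δ n} → Fm s Δ n → MF Δ n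
    _&_ : ∀ {Δ n} → MF Δ n → MF Δ n → MF Δ n
    _⇛_ : ∀ {Δ n} → MF Δ n → MF Δ n → MF Δ n
    ∀¹  : ∀ {Δ n} → MF Δ (suc n) → MF Δ n
    ∀²  : ∀ {Δ n} (κ : Sort × ℕ) → MF (κ ∷ Δ) n → MF Δ n

  renM : ∀ {Δ n m} → (Fin n → Fin m) → MF Δ n → MF Δ m
  renM ρ (fml F)  = fml (ren ρ F)
  renM ρ (M & N)  = renM ρ M & renM ρ N
  renM ρ (M ⇛ N)  = renM ρ M ⇛ renM ρ N
  renM ρ (∀¹ M)   = ∀¹ (renM (liftF ρ) M)
  renM ρ (∀² κ M) = ∀² κ (renM ρ M)

  prenM : ∀ {Δ Δ' n} → (∀ {κ} → Δ ∋ κ → Δ' ∋ κ) → MF Δ n → MF Δ' n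
  prenM ρ (fml F)  = fml (pren ρ F)
  prenM ρ (M & N)  = prenM ρ M & prenM ρ N
  prenM ρ (M ⇛ N)  = prenM ρ M ⇛ prenM ρ N
  prenM ρ (∀¹ M)   = ∀¹ (prenM ρ M)
  prenM ρ (∀² κ M) = ∀² κ (prenM (liftV ρ) M)

  PSub : Ctx → Ctx → ℕ → Set
  PSub Δ Δ' n = ∀ {κ} → Δ ∋ κ → Fm (proj₁ κ) Δ' (proj₂ κ + n)

  extσ : ∀ {Δ Δ' n κ'} → PSub Δ Δ' n → PSub (κ' ∷ Δ) (κ' ∷ Δ') n
  extσ {n = n} σ here      = patom here (tabulate (λ i → i ↑ˡ n))
  extσ         σ (there x) = pren there (σ x)

  psubM : ∀ {Δ Δ' n n'} → PSub Δ Δ' n → (Fin n → Fin n') → MF Δ n' → MF Δ' n'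
  psubM σ θ (fml F)  = fml (psub σ θ F)
  psubM σ θ (M & N)  = psubM σ θ M & psubM σ θ N
  psubM σ θ (M ⇛ N)  = psubM σ θ M ⇛ psubM σ θ N
  psubM σ θ (∀¹ M)   = ∀¹ (psubM σ (suc ∘ θ) M)
  psubM σ θ (∀² κ M) = ∀² κ (psubM (extσ σ) θ M)

  wk¹ : ∀ {Δ n} → MF Δ n → MF Δ (suc n)
  wk¹ = renM suc

  wk² : ∀ {Δ n κ} → MF Δ n → MF (κ ∷ Δ) n
  wk² = prenM there

  sub0 : ∀ {n} → Fin n → Fin (suc n) → Fin n
  sub0 x zero    = x
  sub0 x (suc i) = i

  inst¹ : ∀ {Δ n} → Fin n → MF Δ (suc n) → MF Δ n
  inst¹ x = renM (sub0 x)

  inst² : ∀ {Δ n κ} → Fm (proj₁ κ) Δ (proj₂ κ + n) → MF (κ ∷ Δ) n → MF Δ n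
  inst² {Δ} {n} φ = psubM σ id
    where
    σ : PSub (_ ∷ Δ) Δ n
    σ here      = φ
    σ (there x) = patom x (tabulate (λ i → i ↑ˡ n))

  -- Natural deduction for meta-formulas.  α-conversion is built in
  -- (de Bruijn).  fresh¹ / fresh² let a derivation use individual /
  -- predicate variables not occurring in the hypotheses or conclusion
  -- (there are countably many variables in the paper's framework).
  infix 3 _⊢_
  data _⊢_ : ∀ {Δ n} → List (MF Δ n) → MF Δ n → Set where
    hyp    : ∀ {Δ n} {Γ : List (MF Δ n)} {M} → Γ ∋ M → Γ ⊢ M
    &I     : ∀ {Δ n} {Γ : List (MF Δ n)} {M N} → Γ ⊢ M → Γ ⊢ N → Γ ⊢ M & N
    &E₁    : ∀ {Δ n} {Γ : List (MF Δ n)} {M N} → Γ ⊢ M & N → Γ ⊢ M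
    &E₂    : ∀ {Δ n} {Γ : List (MF Δ n)} {M N} → Γ ⊢ M & N → Γ ⊢ N
    ⇛I     : ∀ {Δ n} {Γ : List (MF Δ n)} {M N} → (M ∷ Γ) ⊢ N → Γ ⊢ M ⇛ N
    ⇛E     : ∀ {Δ n} {Γ : List (MF Δ n)} {M N} → Γ ⊢ M ⇛ N → Γ ⊢ M → Γ ⊢ N
    ∀¹I    : ∀ {Δ n} {Γ : List (MF Δ n)} {M} → lmap wk¹ Γ ⊢ M → Γ ⊢ ∀¹ M
    ∀¹E    : ∀ {Δ n} {Γ : List (MF Δ n)} {M} → Γ ⊢ ∀¹ M → (x : Fin n) → Γ ⊢ inst¹ x M
    ∀²I    : ∀ {Δ n} {Γ : List (MF Δ n)} {κ} {M} →
             lmap (wk² {κ = κ}) Γ ⊢ M → Γ ⊢ ∀² κ M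
    ∀²E    : ∀ {Δ n} {Γ : List (MF Δ n)} {κ} {M} → Γ ⊢ ∀² κ M →
             (φ : Fm (proj₁ κ) Δ (proj₂ κ + n)) → Γ ⊢ inst² φ M
    fresh¹ : ∀ {Δ n} {Γ : List (MF Δ n)} {M} → lmap wk¹ Γ ⊢ wk¹ M → Γ ⊢ M
    fresh² : ∀ {Δ n} {Γ : List (MF Δ n)} {M} (κ : Sort × ℕ) →
             lmap (wk² {κ = κ}) Γ ⊢ wk² M → Γ ⊢ M

  closeI : ∀ {Δ} n → MF Δ n → MF Δ 0
  closeI zero    M = M
  closeI (suc n) M = closeI n (∀¹ M)

  closeP : ∀ Δ → MF Δ 0 → MF [] 0
  closeP []      M = M
  closeP (κ ∷ Δ) M = closeP Δ (∀² κ M)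

  data AnyFm (Δ : Ctx) : Set where
    ⌜_⌝ : ∀ {s n} → Fm s Δ n → AnyFm Δ

  gen : ∀ {Δ} → AnyFm Δ → MF Δ 0
  gen (⌜_⌝ {n = n} F) = closeI n (fml F)

  bigAnd : ∀ {Δ n} → MF Δ n → List (MF Δ n) → MF Δ n
  bigAnd M []       = M
  bigAnd M (N ∷ Ns) = M & bigAnd N Ns

  principle : ∀ Δ {s} n → Fm s Δ n → MF [] 0
  principle Δ n G = closeP Δ (closeI n (fml G))

  rule : ∀ Δ → AnyFm Δ → List (AnyFm Δ) → AnyFm Δ → MF [] 0
  rule Δ F Fs G = closeP Δ (bigAnd (gen F) (lmap gen Fs) ⇛ gen G)

  data RuleOrPrinciple : MF [] 0 → Set where
    isPrinciple : ∀ Δ {s} n (G : Fm s Δ n) → RuleOrPrinciple (principle Δ n G)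
    isRule      : ∀ Δ F Fs G → RuleOrPrinciple (rule Δ F Fs G)

  -- ⊢_L F  for a logic with derivation system D:  D ⇒ F is derivable.
  Derivable : MF [] 0 → MF [] 0 → Set
  Derivable D F = [] ⊢ D ⇛ F

module QHC where

  -- sorts: cl = proper predicate variables / c-formulas,
  --        int = problem variables / i-formulas
  data PSort : Set where
    cl int : PSort

  QCtx : Set
  QCtx = List (PSort × ℕ)

  infixr 8 ⁇_ !_
  infixr 7 _∧_
  infixr 6 _∨_
  infixr 5 _⟶_

  -- Connectives on c-formulas are classical, on i-formulas intuitionistic;
  -- both are built with the same constructors, typed by the sort.
  -- ⁇ is the paper's '?', ! is the paper's '!'.
  data Fm : PSort → QCtx → ℕ → Set where
    ⊤c   : ∀ {Δ n} → Fm cl Δ n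
    ⊥c   : ∀ {Δ n} → Fm cl Δ n
    ✓    : ∀ {Δ n} → Fm int Δ n
    ⋏    : ∀ {Δ n} → Fm int Δ n
    atom : ∀ {Δ n κ} → Δ ∋ κ → Vec (Fin n) (proj₂ κ) → Fm (proj₁ κ) Δ n
    ⁇_   : ∀ {Δ n} → Fm int Δ n → Fm cl Δ n
    !_   : ∀ {Δ n} → Fm cl Δ n → Fm int Δ n
    _∧_  : ∀ {s Δ n} → Fm s Δ n → Fm s Δ n → Fm s Δ n
    _∨_  : ∀ {s Δ n} → Fm s Δ n → Fm s Δ n → Fm s Δ n
    _⟶_  : ∀ {s Δ n} → Fm s Δ n → Fm s Δ n → Fm s Δ n
    Ex   : ∀ {s Δ n} → Fm s Δ (suc n) → Fm s Δ n
    All  : ∀ {s Δ n} → Fm s Δ (suc n) → Fm s Δ n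

  verum falsum : ∀ s {Δ n} → Fm s Δ n
  verum cl  = ⊤c
  verum int = ✓
  falsum cl  = ⊥c
  falsum int = ⋏

  infixr 8 ¬_
  infix 4 _↔_
  ¬_ : ∀ {s Δ n} → Fm s Δ n → Fm s Δ n
  ¬_ {s} F = F ⟶ falsum s

  _↔_ : ∀ {s Δ n} → Fm s Δ n → Fm s Δ n → Fm s Δ n
  F ↔ G = (F ⟶ G) ∧ (G ⟶ F)

  ren : ∀ {s Δ n m} → (Fin n → Fin m) → Fm s Δ n → Fm s Δ m
  ren ρ ⊤c          = ⊤c
  ren ρ ⊥c          = ⊥c
  ren ρ ✓           = ✓
  ren ρ ⋏           = ⋏
  ren ρ (atom x ys) = atom x (vmap ρ ys)
  ren ρ (⁇ F)       = ⁇ ren ρ F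
  ren ρ (! F)       = ! ren ρ F
  ren ρ (F ∧ G)     = ren ρ F ∧ ren ρ G
  ren ρ (F ∨ G)     = ren ρ F ∨ ren ρ G
  ren ρ (F ⟶ G)     = ren ρ F ⟶ ren ρ G
  ren ρ (Ex F)      = Ex (ren (liftF ρ) F)
  ren ρ (All F)     = All (ren (liftF ρ) F)

  pren : ∀ {s Δ Δ' n} → (∀ {κ} → Δ ∋ κ → Δ' ∋ κ) → Fm s Δ n → Fm s Δ' n
  pren ρ ⊤c          = ⊤c
  pren ρ ⊥c          = ⊥c
  pren ρ ✓           = ✓
  pren ρ ⋏           = ⋏
  pren ρ (atom x ys) = atom (ρ x) ys
  pren ρ (⁇ F)       = ⁇ pren ρ F
  pren ρ (! F)       = ! pren ρ F
  pren ρ (F ∧ G)     = pren ρ F ∧ pren ρ G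
  pren ρ (F ∨ G)     = pren ρ F ∨ pren ρ G
  pren ρ (F ⟶ G)     = pren ρ F ⟶ pren ρ G
  pren ρ (Ex F)      = Ex (pren ρ F)
  pren ρ (All F)     = All (pren ρ F)

  psub : ∀ {s Δ Δ' n n'} →
         (∀ {κ} → Δ ∋ κ → Fm (proj₁ κ) Δ' (proj₂ κ + n)) →
         (Fin n → Fin n') → Fm s Δ n' → Fm s Δ' n'
  psub σ θ ⊤c                    = ⊤c
  psub σ θ ⊥c                    = ⊥c
  psub σ θ ✓                     = ✓
  psub σ θ ⋏                     = ⋏
  psub σ θ (atom {κ = κ} x ys)   = ren ([ lookup ys , θ ] ∘ splitAt (proj₂ κ)) (σ x)
  psub σ θ (⁇ F)                 = ⁇ psub σ θ F
  psub σ θ (! F)                 = ! psub σ θ F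
  psub σ θ (F ∧ G)               = psub σ θ F ∧ psub σ θ G
  psub σ θ (F ∨ G)               = psub σ θ F ∨ psub σ θ G
  psub σ θ (F ⟶ G)               = psub σ θ F ⟶ psub σ θ G
  psub σ θ (Ex F)                = Ex (psub σ (suc ∘ θ) F)
  psub σ θ (All F)               = All (psub σ (suc ∘ θ) F)

  syn : Syntax
  syn = record { Sort = PSort ; Fm = Fm ; ren = ren ; pren = pren
               ; patom = atom ; psub = psub }

  open Framework syn public

  v : ∀ {Δ n s} → Δ ∋ (s , 0) → Fm s Δ n
  v x = atom x []

  u : ∀ {Δ n s} → Δ ∋ (s , 1) → Fin n → Fm s Δ n
  u x y = atom x (y ∷ [])

  #0 : ∀ {A : Set} {a : A} {as} → (a ∷ as) ∋ a
  #0 = here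
  #1 : ∀ {A : Set} {a b : A} {as} → (b ∷ a ∷ as) ∋ a
  #1 = there here
  #2 : ∀ {A : Set} {a b c : A} {as} → (c ∷ b ∷ a ∷ as) ∋ a
  #2 = there (there here)

  P1 P2 P3 : PSort → QCtx
  P1 s = (s , 0) ∷ []
  P2 s = (s , 0) ∷ (s , 0) ∷ []
  P3 s = (s , 0) ∷ (s , 0) ∷ (s , 0) ∷ []

  basicLogic : PSort → List (MF [] 0)
  basicLogic s =
      principle (P2 s) 0 (v #0 ⟶ (v #1 ⟶ v #0))
    ∷ principle (P3 s) 0 ((v #0 ⟶ (v #1 ⟶ v #2)) ⟶ ((v #0 ⟶ v #1) ⟶ (v #0 ⟶ v #2)))
    ∷ principle (P2 s) 0 ((v #0 ∧ v #1) ⟶ v #0)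
    ∷ principle (P2 s) 0 ((v #0 ∧ v #1) ⟶ v #1)
    ∷ principle (P2 s) 0 (v #0 ⟶ (v #1 ⟶ (v #0 ∧ v #1)))
    ∷ principle (P2 s) 0 (v #0 ⟶ (v #0 ∨ v #1))
    ∷ principle (P2 s) 0 (v #1 ⟶ (v #0 ∨ v #1))
    ∷ principle (P3 s) 0 ((v #0 ⟶ v #2) ⟶ ((v #1 ⟶ v #2) ⟶ ((v #0 ∨ v #1) ⟶ v #2)))
    ∷ principle (P1 s) 0 (falsum s ⟶ v #0)
    ∷ principle [] 0 (verum s)
    ∷ principle ((s , 1) ∷ []) 1 (All (u #0 zero) ⟶ u #0 zero)
    ∷ principle ((s , 1) ∷ []) 1 (u #0 zero ⟶ Ex (u #0 zero))
    ∷ rule (P2 s) ⌜ v {n = 0} #0 ⌝ (⌜ v {n = 0} #0 ⟶ v #1 ⌝ ∷ []) ⌜ v {n = 0} #1 ⌝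
    ∷ rule ((s , 0) ∷ (s , 1) ∷ []) ⌜ v {n = 1} #0 ⟶ u #1 zero ⌝ []
                                    ⌜ v {n = 0} #0 ⟶ All (u #1 zero) ⌝
    ∷ rule ((s , 0) ∷ (s , 1) ∷ []) ⌜ u {n = 1} #1 zero ⟶ v #0 ⌝ []
                                    ⌜ Ex {n = 0} (u #1 zero) ⟶ v #0 ⌝
    ∷ []

  QCpart : List (MF [] 0)
  QCpart = principle (P1 cl) 0 (¬ ¬ v {n = 0} #0 ⟶ v #0) ∷ basicLogic cl

  QHpart : List (MF [] 0)
  QHpart = basicLogic int

  QHCspecific : List (MF [] 0)
  QHCspecific =
      principle (P2 int) 0 (⁇ (v #0 ∧ v #1) ↔ (⁇ v #0) ∧ (⁇ v #1))
    ∷ principle (P2 int) 0 (⁇ (v #0 ∨ v #1) ↔ (⁇ v #0) ∨ (⁇ v #1))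
    ∷ principle (P2 int) 0 (⁇ (v #0 ⟶ v #1) ⟶ ((⁇ v #0) ⟶ (⁇ v #1)))
    ∷ principle [] 0 (¬ (⁇ ⋏))
    ∷ principle ((int , 1) ∷ []) 0 (⁇ Ex (u #0 zero) ↔ Ex (⁇ u #0 zero))
    ∷ principle ((int , 1) ∷ []) 0 (⁇ All (u #0 zero) ⟶ All (⁇ u #0 zero))
    ∷ principle (P1 int) 0 (v #0 ⟶ ! ⁇ v #0)
    ∷ principle [] 0 (¬ (! ⊥c))
    ∷ principle (P1 cl) 0 (⁇ ! v #0 ⟶ v #0)
    ∷ principle (P1 cl) 0 (! v #0 ⟶ ! ⁇ ! v #0)
    ∷ principle (P2 cl) 0 (! (v #0 ⟶ v #1) ⟶ ((! v #0) ⟶ (! v #1)))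
    ∷ rule (P1 cl) ⌜ ! v {n = 0} #0 ⌝ [] ⌜ v {n = 0} #0 ⌝
    ∷ rule (P1 cl) ⌜ v {n = 0} #0 ⌝ [] ⌜ ! v {n = 0} #0 ⌝
    ∷ []

  Hprinciple : MF [] 0
  Hprinciple = principle (P1 int) 0 (⁇ (v #0 ∨ ¬ v #0))

  _++'_ : ∀ {A : Set} → List A → List A → List A
  []       ++' ys = ys
  (x ∷ xs) ++' ys = x ∷ (xs ++' ys)

  D-QHCH : MF [] 0
  D-QHCH = bigAnd Hprinciple (QCpart ++' (QHpart ++' QHCspecific))

module QS5 where

  data S5Sort : Set where
    ∗ : S5Sort

  SCtx : Set
  SCtx = List (S5Sort × ℕ)

  infixr 8 □_
  infixr 7 _∧_
  infixr 6 _∨_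
  infixr 5 _⟶_

  data Fm : S5Sort → SCtx → ℕ → Set where
    ⊤c   : ∀ {Δ n} → Fm ∗ Δ n
    ⊥c   : ∀ {Δ n} → Fm ∗ Δ n
    atom : ∀ {Δ n κ} → Δ ∋ κ → Vec (Fin n) (proj₂ κ) → Fm (proj₁ κ) Δ n
    □_   : ∀ {s Δ n} → Fm s Δ n → Fm s Δ n
    _∧_  : ∀ {s Δ n} → Fm s Δ n → Fm s Δ n → Fm s Δ n
    _∨_  : ∀ {s Δ n} → Fm s Δ n → Fm s Δ n → Fm s Δ n
    _⟶_  : ∀ {s Δ n} → Fm s Δ n → Fm s Δ n → Fm s Δ n
    Ex   : ∀ {s Δ n} → Fm s Δ (suc n) → Fm s Δ n
    All  : ∀ {s Δ n} → Fm s Δ (suc n) → Fm s Δ n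

  infixr 8 ¬_ ◇_
  ¬_ : ∀ {s Δ n} → Fm s Δ n → Fm s Δ n
  ¬_ {∗} F = F ⟶ ⊥c

  ◇_ : ∀ {s Δ n} → Fm s Δ n → Fm s Δ n
  ◇ F = ¬ □ ¬ F

  ren : ∀ {s Δ n m} → (Fin n → Fin m) → Fm s Δ n → Fm s Δ m
  ren ρ ⊤c          = ⊤c
  ren ρ ⊥c          = ⊥c
  ren ρ (atom x ys) = atom x (vmap ρ ys)
  ren ρ (□ F)       = □ ren ρ F
  ren ρ (F ∧ G)     = ren ρ F ∧ ren ρ G
  ren ρ (F ∨ G)     = ren ρ F ∨ ren ρ G
  ren ρ (F ⟶ G)     = ren ρ F ⟶ ren ρ G
  ren ρ (Ex F)      = Ex (ren (liftF ρ) F)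
  ren ρ (All F)     = All (ren (liftF ρ) F)

  pren : ∀ {s Δ Δ' n} → (∀ {κ} → Δ ∋ κ → Δ' ∋ κ) → Fm s Δ n → Fm s Δ' n
  pren ρ ⊤c          = ⊤c
  pren ρ ⊥c          = ⊥c
  pren ρ (atom x ys) = atom (ρ x) ys
  pren ρ (□ F)       = □ pren ρ F
  pren ρ (F ∧ G)     = pren ρ F ∧ pren ρ G
  pren ρ (F ∨ G)     = pren ρ F ∨ pren ρ G
  pren ρ (F ⟶ G)     = pren ρ F ⟶ pren ρ G
  pren ρ (Ex F)      = Ex (pren ρ F)
  pren ρ (All F)     = All (pren ρ F)

  psub : ∀ {s Δ Δ' n n'} →
         (∀ {κ} → Δ ∋ κ → Fm (proj₁ κ) Δ' (proj₂ κ + n)) →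
         (Fin n → Fin n') → Fm s Δ n' → Fm s Δ' n'
  psub σ θ ⊤c                    = ⊤c
  psub σ θ ⊥c                    = ⊥c
  psub σ θ (atom {κ = κ} x ys)   = ren ([ lookup ys , θ ] ∘ splitAt (proj₂ κ)) (σ x)
  psub σ θ (□ F)                 = □ psub σ θ F
  psub σ θ (F ∧ G)               = psub σ θ F ∧ psub σ θ G
  psub σ θ (F ∨ G)               = psub σ θ F ∨ psub σ θ G
  psub σ θ (F ⟶ G)               = psub σ θ F ⟶ psub σ θ G
  psub σ θ (Ex F)                = Ex (psub σ (suc ∘ θ) F)
  psub σ θ (All F)               = All (psub σ (suc ∘ θ) F)

  syn : Syntax
  syn = record { Sort = S5Sort ; Fm = Fm ; ren = ren ; pren = pren
               ; patom = atom ; psub = psub }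

  open Framework syn public

  v : ∀ {Δ n} → Δ ∋ (∗ , 0) → Fm ∗ Δ n
  v x = atom x []

  u : ∀ {Δ n} → Δ ∋ (∗ , 1) → Fin n → Fm ∗ Δ n
  u x y = atom x (y ∷ [])

  P1 P2 P3 : SCtx
  P1 = (∗ , 0) ∷ []
  P2 = (∗ , 0) ∷ (∗ , 0) ∷ []
  P3 = (∗ , 0) ∷ (∗ , 0) ∷ (∗ , 0) ∷ []

  #0 : ∀ {A : Set} {a : A} {as} → (a ∷ as) ∋ a
  #0 = here
  #1 : ∀ {A : Set} {a b : A} {as} → (b ∷ a ∷ as) ∋ a
  #1 = there here
  #2 : ∀ {A : Set} {a b c : A} {as} → (c ∷ b ∷ a ∷ as) ∋ a
  #2 = there (there here)

  -- QC (same axiomatisation as the c-part of QHC)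
  QCpart : List (MF [] 0)
  QCpart =
      principle P1 0 (¬ ¬ v {n = 0} #0 ⟶ v #0)
    ∷ principle P2 0 (v #0 ⟶ (v #1 ⟶ v #0))
    ∷ principle P3 0 ((v #0 ⟶ (v #1 ⟶ v #2)) ⟶ ((v #0 ⟶ v #1) ⟶ (v #0 ⟶ v #2)))
    ∷ principle P2 0 ((v #0 ∧ v #1) ⟶ v #0)
    ∷ principle P2 0 ((v #0 ∧ v #1) ⟶ v #1)
    ∷ principle P2 0 (v #0 ⟶ (v #1 ⟶ (v #0 ∧ v #1)))
    ∷ principle P2 0 (v #0 ⟶ (v #0 ∨ v #1))
    ∷ principle P2 0 (v #1 ⟶ (v #0 ∨ v #1))
    ∷ principle P3 0 ((v #0 ⟶ v #2) ⟶ ((v #1 ⟶ v #2) ⟶ ((v #0 ∨ v #1) ⟶ v #2)))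
    ∷ principle P1 0 (⊥c ⟶ v #0)
    ∷ principle [] 0 (⊤c {n = 0})
    ∷ principle ((∗ , 1) ∷ []) 1 (All (u #0 zero) ⟶ u #0 zero)
    ∷ principle ((∗ , 1) ∷ []) 1 (u #0 zero ⟶ Ex (u #0 zero))
    ∷ rule P2 ⌜ v {n = 0} #0 ⌝ (⌜ v {n = 0} #0 ⟶ v #1 ⌝ ∷ []) ⌜ v {n = 0} #1 ⌝
    ∷ rule ((∗ , 0) ∷ (∗ , 1) ∷ []) ⌜ v {n = 1} #0 ⟶ u #1 zero ⌝ []
                                    ⌜ v {n = 0} #0 ⟶ All (u #1 zero) ⌝
    ∷ rule ((∗ , 0) ∷ (∗ , 1) ∷ []) ⌜ u {n = 1} #1 zero ⟶ v #0 ⌝ []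
                                    ⌜ Ex {n = 0} (u #1 zero) ⟶ v #0 ⌝
    ∷ []

  S5part : List (MF [] 0)
  S5part =
      principle P1 0 (□ v {n = 0} #0 ⟶ v #0)
    ∷ principle P1 0 (□ v {n = 0} #0 ⟶ □ □ v #0)
    ∷ principle P2 0 (□ (v {n = 0} #0 ⟶ v #1) ⟶ (□ v #0 ⟶ □ v #1))
    ∷ principle P1 0 (◇ v {n = 0} #0 ⟶ □ ◇ v #0)
    ∷ rule P1 ⌜ v {n = 0} #0 ⌝ [] ⌜ □ v {n = 0} #0 ⌝
    ∷ []

  _++'_ : ∀ {A : Set} → List A → List A → List A
  []       ++' ys = ys
  (x ∷ xs) ++' ys = x ∷ (xs ++' ys)

  D-QS5 : MF [] 0
  D-QS5 = bigAnd (principle [] 0 (⊤c {n = 0})) (QCpart ++' S5part)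

module Translation where
  open QHC using (cl)

  trK : QS5.S5Sort × ℕ → QHC.PSort × ℕ
  trK κ = (cl , proj₂ κ)

  trCtx : QS5.SCtx → QHC.QCtx
  trCtx = lmap trK

  trVar : ∀ {Δ κ} → Δ ∋ κ → trCtx Δ ∋ trK κ
  trVar here      = here
  trVar (there x) = there (trVar x)

  tr : ∀ {s Δ n} → QS5.Fm s Δ n → QHC.Fm cl (trCtx Δ) n
  tr QS5.⊤c          = QHC.⊤c
  tr QS5.⊥c          = QHC.⊥c
  tr (QS5.atom x ys) = QHC.atom (trVar x) ys
  tr (QS5.□ F)       = QHC.⁇ QHC.! tr F
  tr (F QS5.∧ G)     = tr F QHC.∧ tr G
  tr (F QS5.∨ G)     = tr F QHC.∨ tr G
  tr (F QS5.⟶ G)     = tr F QHC.⟶ tr G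
  tr (QS5.Ex F)      = QHC.Ex (tr F)
  tr (QS5.All F)     = QHC.All (tr F)

  trM : ∀ {Δ n} → QS5.MF Δ n → QHC.MF (trCtx Δ) n
  trM (QS5.fml F)  = QHC.fml (tr F)
  trM (M QS5.& N)  = trM M QHC.& trM N
  trM (M QS5.⇛ N)  = trM M QHC.⇛ trM N
  trM (QS5.∀¹ M)   = QHC.∀¹ (trM M)
  trM (QS5.∀² κ M) = QHC.∀² (trK κ) (trM M)

-- QS5 embeds into QHC+H by reading □ as ?!, and QHC+H is interpreted back in QS5 by erasing
-- ? and ! and reading every i-formula Φ as □Φ, the Gödel–McKinsey–Tarski reading of
-- intuitionistic logic in S4.  Both maps commute with renaming and with substitution for
-- predicate variables, so they carry meta-level derivations to derivations; it remains to
-- derive the translated axioms of each system in the other.  Beyond S4 the two sides meet in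
-- H and 5: H yields axiom 5 for ?!, and the erasure □(□γ ∨ □(□γ → □⊥)) of H holds in S5
-- because ¬□γ is necessary there.  Since erasure undoes the embedding, derivability of the
-- image of R in QHC+H gives derivability of R in QS5.

module Submission where

open import Defs
open import Function.Bundles using (_⇔_; mk⇔)
open import Data.Nat using (ℕ; zero; suc; _+_)
open import Data.Fin using (Fin; zero; suc; _↑ˡ_; splitAt; #_)
open import Data.Fin.Properties using (splitAt-↑ˡ)
open import Data.Vec using (Vec; []; _∷_; lookup; tabulate) renaming (map to vmap)
open import Data.Vec.Properties using (tabulate∘lookup; tabulate-∘; tabulate-cong; map-cong; map-∘; map-id)
open import Data.List using (List; []; _∷_; length) renaming (map to lmap; lookup to lookupL)
import Data.List.Relation.Unary.All as All
open All using ([]; _∷_; tail)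
open import Data.List.Relation.Unary.All.Properties using (++⁺; ++⁻ˡ)
open import Data.Product using (_×_; _,_; proj₁; proj₂)
open import Data.Sum using ([_,_]; [_,_]′)
open import Function using (_∘_; id)
open import Relation.Binary.PropositionalEquality hiding ([_])

Renaming : ∀ {A : Set} → List A → List A → Set
Renaming Δ Δ' = ∀ {κ} → Δ ∋ κ → Δ' ∋ κ

map-∋ : ∀ {A B : Set} (f : A → B) {xs : List A} {x} → xs ∋ x → lmap f xs ∋ f x
map-∋ f here      = here
map-∋ f (there p) = there (map-∋ f p)

map-⊆ : ∀ {A B : Set} (f : A → B) {xs ys : List A} → Renaming xs ys → Renaming (lmap f xs) (lmap f ys)
map-⊆ f {_ ∷ _} ⊆ here      = map-∋ f (⊆ here)
map-⊆ f {_ ∷ _} ⊆ (there p) = map-⊆ f (⊆ ∘ there) p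

argPlaces : ∀ k n → Vec (Fin (k + n)) k
argPlaces k n = tabulate (_↑ˡ n)

map-[lookup,θ]-argPlaces : ∀ {n n'} k (ys : Vec (Fin n') k) (θ : Fin n → Fin n') →
  vmap ([ lookup ys , θ ] ∘ splitAt k) (argPlaces k n) ≡ ys
map-[lookup,θ]-argPlaces {n} k ys θ = begin
  vmap ([ lookup ys , θ ] ∘ splitAt k) (tabulate (_↑ˡ n))
    ≡⟨ tabulate-∘ _ _ ⟨
  tabulate ([ lookup ys , θ ] ∘ splitAt k ∘ (_↑ˡ n))
    ≡⟨ tabulate-cong (λ i → cong [ lookup ys , θ ] (splitAt-↑ˡ k i n)) ⟩
  tabulate (lookup ys)
    ≡⟨ tabulate∘lookup ys ⟩
  ys ∎
  where open ≡-Reasoning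

record SyntaxLaws (L : Syntax) : Set₁ where
  open Syntax L
  open Framework L using (PSub)
  field
    ren-id     : ∀ {s Δ n} {f : Fin n → Fin n} → (∀ i → f i ≡ i) → (F : Fm s Δ n) → ren f F ≡ F
    pren-cong  : ∀ {s Δ Δ' n} {ρ ρ' : Renaming Δ Δ'} → (∀ {κ} (x : Δ ∋ κ) → ρ x ≡ ρ' x) →
                 (F : Fm s Δ n) → pren ρ F ≡ pren ρ' F
    pren-patom : ∀ {Δ Δ' n κ} (ρ : Renaming Δ Δ') (x : Δ ∋ κ) (ys : Vec (Fin n) (proj₂ κ)) →
                 pren ρ (patom x ys) ≡ patom (ρ x) ys
    pren-id    : ∀ {s Δ n} {ρ : Renaming Δ Δ} → (∀ {κ} (x : Δ ∋ κ) → ρ x ≡ x) →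
                 (F : Fm s Δ n) → pren ρ F ≡ F
    psub-cong  : ∀ {s Δ Δ' n n'} {σ σ' : PSub Δ Δ' n} {θ : Fin n → Fin n'} →
                 (∀ {κ} (x : Δ ∋ κ) → σ x ≡ σ' x) → (F : Fm s Δ n') → psub σ θ F ≡ psub σ' θ F
    psub-pren  : ∀ {s Δ₀ Δ Δ' n n'} (σ : PSub Δ Δ' n) (θ : Fin n → Fin n') (ρ : Renaming Δ₀ Δ)
                 (F : Fm s Δ₀ n') → psub σ θ (pren ρ F) ≡ psub (σ ∘ ρ) θ F
    psub-var   : ∀ {s Δ Δ' n n'} {σ : PSub Δ Δ' n} (ρ : Renaming Δ Δ') →
                 (∀ {κ} (x : Δ ∋ κ) → σ x ≡ patom (ρ x) (argPlaces (proj₂ κ) n)) →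
                 (θ : Fin n → Fin n') (F : Fm s Δ n') → psub σ θ F ≡ pren ρ F

module QS5Laws where
  open QS5

  ren-cong : ∀ {s Δ n m} {f g : Fin n → Fin m} → (∀ i → f i ≡ g i) → (F : Fm s Δ n) → ren f F ≡ ren g F
  ren-cong e ⊤c          = refl
  ren-cong e ⊥c          = refl
  ren-cong e (atom x ys) = cong (atom x) (map-cong e ys)
  ren-cong e (□ F)       = cong □_ (ren-cong e F)
  ren-cong e (F ∧ G)     = cong₂ _∧_ (ren-cong e F) (ren-cong e G)
  ren-cong e (F ∨ G)     = cong₂ _∨_ (ren-cong e F) (ren-cong e G)
  ren-cong e (F ⟶ G)     = cong₂ _⟶_ (ren-cong e F) (ren-cong e G)
  ren-cong e (Ex F)      = cong Ex (ren-cong (λ { zero → refl ; (suc i) → cong suc (e i) }) F)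
  ren-cong e (All F)     = cong All (ren-cong (λ { zero → refl ; (suc i) → cong suc (e i) }) F)

  ren-id : ∀ {s Δ n} {f : Fin n → Fin n} → (∀ i → f i ≡ i) → (F : Fm s Δ n) → ren f F ≡ F
  ren-id e ⊤c          = refl
  ren-id e ⊥c          = refl
  ren-id e (atom x ys) = cong (atom x) (trans (map-cong e ys) (map-id ys))
  ren-id e (□ F)       = cong □_ (ren-id e F)
  ren-id e (F ∧ G)     = cong₂ _∧_ (ren-id e F) (ren-id e G)
  ren-id e (F ∨ G)     = cong₂ _∨_ (ren-id e F) (ren-id e G)
  ren-id e (F ⟶ G)     = cong₂ _⟶_ (ren-id e F) (ren-id e G)
  ren-id e (Ex F)      = cong Ex (ren-id (λ { zero → refl ; (suc i) → cong suc (e i) }) F)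
  ren-id e (All F)     = cong All (ren-id (λ { zero → refl ; (suc i) → cong suc (e i) }) F)

  liftF-∘ : ∀ {n m k} {f : Fin m → Fin k} {g : Fin n → Fin m} (i : Fin (suc n)) →
            liftF f (liftF g i) ≡ liftF (f ∘ g) i
  liftF-∘ zero    = refl
  liftF-∘ (suc i) = refl

  ren-∘ : ∀ {s Δ n m k} (f : Fin m → Fin k) (g : Fin n → Fin m) (F : Fm s Δ n) →
          ren f (ren g F) ≡ ren (f ∘ g) F
  ren-∘ f g ⊤c          = refl
  ren-∘ f g ⊥c          = refl
  ren-∘ f g (atom x ys) = cong (atom x) (sym (map-∘ f g ys))
  ren-∘ f g (□ F)       = cong □_ (ren-∘ f g F)
  ren-∘ f g (F ∧ G)     = cong₂ _∧_ (ren-∘ f g F) (ren-∘ f g G)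
  ren-∘ f g (F ∨ G)     = cong₂ _∨_ (ren-∘ f g F) (ren-∘ f g G)
  ren-∘ f g (F ⟶ G)     = cong₂ _⟶_ (ren-∘ f g F) (ren-∘ f g G)
  ren-∘ f g (Ex F)      = cong Ex (trans (ren-∘ (liftF f) (liftF g) F) (ren-cong liftF-∘ F))
  ren-∘ f g (All F)     = cong All (trans (ren-∘ (liftF f) (liftF g) F) (ren-cong liftF-∘ F))

  ren-sub0-liftF : ∀ {s Δ n} (F : Fm s Δ (suc n)) → ren (sub0 zero) (ren (liftF suc) F) ≡ F
  ren-sub0-liftF F = trans (ren-∘ _ _ F) (ren-id (λ { zero → refl ; (suc _) → refl }) F)

  pren-cong : ∀ {s Δ Δ' n} {ρ ρ' : Renaming Δ Δ'} → (∀ {κ} (x : Δ ∋ κ) → ρ x ≡ ρ' x) →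
              (F : Fm s Δ n) → pren ρ F ≡ pren ρ' F
  pren-cong e ⊤c          = refl
  pren-cong e ⊥c          = refl
  pren-cong e (atom x ys) = cong (λ z → atom z ys) (e x)
  pren-cong e (□ F)       = cong □_ (pren-cong e F)
  pren-cong e (F ∧ G)     = cong₂ _∧_ (pren-cong e F) (pren-cong e G)
  pren-cong e (F ∨ G)     = cong₂ _∨_ (pren-cong e F) (pren-cong e G)
  pren-cong e (F ⟶ G)     = cong₂ _⟶_ (pren-cong e F) (pren-cong e G)
  pren-cong e (Ex F)      = cong Ex (pren-cong e F)
  pren-cong e (All F)     = cong All (pren-cong e F)

  pren-id : ∀ {s Δ n} {ρ : Renaming Δ Δ} → (∀ {κ} (x : Δ ∋ κ) → ρ x ≡ x) →
            (F : Fm s Δ n) → pren ρ F ≡ F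
  pren-id e ⊤c          = refl
  pren-id e ⊥c          = refl
  pren-id e (atom x ys) = cong (λ z → atom z ys) (e x)
  pren-id e (□ F)       = cong □_ (pren-id e F)
  pren-id e (F ∧ G)     = cong₂ _∧_ (pren-id e F) (pren-id e G)
  pren-id e (F ∨ G)     = cong₂ _∨_ (pren-id e F) (pren-id e G)
  pren-id e (F ⟶ G)     = cong₂ _⟶_ (pren-id e F) (pren-id e G)
  pren-id e (Ex F)      = cong Ex (pren-id e F)
  pren-id e (All F)     = cong All (pren-id e F)

  psub-cong : ∀ {s Δ Δ' n n'} {σ σ' : PSub Δ Δ' n} {θ : Fin n → Fin n'} →
              (∀ {κ} (x : Δ ∋ κ) → σ x ≡ σ' x) → (F : Fm s Δ n') → psub σ θ F ≡ psub σ' θ F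
  psub-cong e ⊤c          = refl
  psub-cong e ⊥c          = refl
  psub-cong e (atom x ys) = cong (ren _) (e x)
  psub-cong e (□ F)       = cong □_ (psub-cong e F)
  psub-cong e (F ∧ G)     = cong₂ _∧_ (psub-cong e F) (psub-cong e G)
  psub-cong e (F ∨ G)     = cong₂ _∨_ (psub-cong e F) (psub-cong e G)
  psub-cong e (F ⟶ G)     = cong₂ _⟶_ (psub-cong e F) (psub-cong e G)
  psub-cong e (Ex F)      = cong Ex (psub-cong e F)
  psub-cong e (All F)     = cong All (psub-cong e F)

  psub-pren : ∀ {s Δ₀ Δ Δ' n n'} (σ : PSub Δ Δ' n) (θ : Fin n → Fin n') (ρ : Renaming Δ₀ Δ)
              (F : Fm s Δ₀ n') → psub σ θ (pren ρ F) ≡ psub (σ ∘ ρ) θ F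
  psub-pren σ θ ρ ⊤c          = refl
  psub-pren σ θ ρ ⊥c          = refl
  psub-pren σ θ ρ (atom x ys) = refl
  psub-pren σ θ ρ (□ F)       = cong □_ (psub-pren σ θ ρ F)
  psub-pren σ θ ρ (F ∧ G)     = cong₂ _∧_ (psub-pren σ θ ρ F) (psub-pren σ θ ρ G)
  psub-pren σ θ ρ (F ∨ G)     = cong₂ _∨_ (psub-pren σ θ ρ F) (psub-pren σ θ ρ G)
  psub-pren σ θ ρ (F ⟶ G)     = cong₂ _⟶_ (psub-pren σ θ ρ F) (psub-pren σ θ ρ G)
  psub-pren σ θ ρ (Ex F)      = cong Ex (psub-pren σ (suc ∘ θ) ρ F)
  psub-pren σ θ ρ (All F)     = cong All (psub-pren σ (suc ∘ θ) ρ F)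

  psub-var : ∀ {s Δ Δ' n n'} {σ : PSub Δ Δ' n} (ρ : Renaming Δ Δ') →
             (∀ {κ} (x : Δ ∋ κ) → σ x ≡ atom (ρ x) (argPlaces (proj₂ κ) n)) →
             (θ : Fin n → Fin n') (F : Fm s Δ n') → psub σ θ F ≡ pren ρ F
  psub-var ρ e θ ⊤c                  = refl
  psub-var ρ e θ ⊥c                  = refl
  psub-var ρ e θ (atom {κ = κ} x ys) =
    trans (cong (ren _) (e x)) (cong (atom (ρ x)) (map-[lookup,θ]-argPlaces (proj₂ κ) ys θ))
  psub-var ρ e θ (□ F)               = cong □_ (psub-var ρ e θ F)
  psub-var ρ e θ (F ∧ G)             = cong₂ _∧_ (psub-var ρ e θ F) (psub-var ρ e θ G)
  psub-var ρ e θ (F ∨ G)             = cong₂ _∨_ (psub-var ρ e θ F) (psub-var ρ e θ G)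
  psub-var ρ e θ (F ⟶ G)             = cong₂ _⟶_ (psub-var ρ e θ F) (psub-var ρ e θ G)
  psub-var ρ e θ (Ex F)              = cong Ex (psub-var ρ e (suc ∘ θ) F)
  psub-var ρ e θ (All F)             = cong All (psub-var ρ e (suc ∘ θ) F)

  laws : SyntaxLaws syn
  laws = record { ren-id = ren-id ; pren-cong = pren-cong ; pren-patom = λ _ _ _ → refl ; pren-id = pren-id
                ; psub-cong = psub-cong ; psub-pren = psub-pren ; psub-var = psub-var }

module QHCLaws where
  open QHC

  ren-id : ∀ {s Δ n} {f : Fin n → Fin n} → (∀ i → f i ≡ i) → (F : Fm s Δ n) → ren f F ≡ F
  ren-id e ⊤c          = refl
  ren-id e ⊥c          = refl
  ren-id e ✓           = refl
  ren-id e ⋏           = refl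
  ren-id e (atom x ys) = cong (atom x) (trans (map-cong e ys) (map-id ys))
  ren-id e (⁇ F)       = cong ⁇_ (ren-id e F)
  ren-id e (! F)       = cong !_ (ren-id e F)
  ren-id e (F ∧ G)     = cong₂ _∧_ (ren-id e F) (ren-id e G)
  ren-id e (F ∨ G)     = cong₂ _∨_ (ren-id e F) (ren-id e G)
  ren-id e (F ⟶ G)     = cong₂ _⟶_ (ren-id e F) (ren-id e G)
  ren-id e (Ex F)      = cong Ex (ren-id (λ { zero → refl ; (suc i) → cong suc (e i) }) F)
  ren-id e (All F)     = cong All (ren-id (λ { zero → refl ; (suc i) → cong suc (e i) }) F)

  pren-cong : ∀ {s Δ Δ' n} {ρ ρ' : Renaming Δ Δ'} → (∀ {κ} (x : Δ ∋ κ) → ρ x ≡ ρ' x) →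
              (F : Fm s Δ n) → pren ρ F ≡ pren ρ' F
  pren-cong e ⊤c          = refl
  pren-cong e ⊥c          = refl
  pren-cong e ✓           = refl
  pren-cong e ⋏           = refl
  pren-cong e (atom x ys) = cong (λ z → atom z ys) (e x)
  pren-cong e (⁇ F)       = cong ⁇_ (pren-cong e F)
  pren-cong e (! F)       = cong !_ (pren-cong e F)
  pren-cong e (F ∧ G)     = cong₂ _∧_ (pren-cong e F) (pren-cong e G)
  pren-cong e (F ∨ G)     = cong₂ _∨_ (pren-cong e F) (pren-cong e G)
  pren-cong e (F ⟶ G)     = cong₂ _⟶_ (pren-cong e F) (pren-cong e G)
  pren-cong e (Ex F)      = cong Ex (pren-cong e F)
  pren-cong e (All F)     = cong All (pren-cong e F)

  pren-id : ∀ {s Δ n} {ρ : Renaming Δ Δ} → (∀ {κ} (x : Δ ∋ κ) → ρ x ≡ x) →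
            (F : Fm s Δ n) → pren ρ F ≡ F
  pren-id e ⊤c          = refl
  pren-id e ⊥c          = refl
  pren-id e ✓           = refl
  pren-id e ⋏           = refl
  pren-id e (atom x ys) = cong (λ z → atom z ys) (e x)
  pren-id e (⁇ F)       = cong ⁇_ (pren-id e F)
  pren-id e (! F)       = cong !_ (pren-id e F)
  pren-id e (F ∧ G)     = cong₂ _∧_ (pren-id e F) (pren-id e G)
  pren-id e (F ∨ G)     = cong₂ _∨_ (pren-id e F) (pren-id e G)
  pren-id e (F ⟶ G)     = cong₂ _⟶_ (pren-id e F) (pren-id e G)
  pren-id e (Ex F)      = cong Ex (pren-id e F)
  pren-id e (All F)     = cong All (pren-id e F)

  psub-cong : ∀ {s Δ Δ' n n'} {σ σ' : PSub Δ Δ' n} {θ : Fin n → Fin n'} →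
              (∀ {κ} (x : Δ ∋ κ) → σ x ≡ σ' x) → (F : Fm s Δ n') → psub σ θ F ≡ psub σ' θ F
  psub-cong e ⊤c          = refl
  psub-cong e ⊥c          = refl
  psub-cong e ✓           = refl
  psub-cong e ⋏           = refl
  psub-cong e (atom x ys) = cong (ren _) (e x)
  psub-cong e (⁇ F)       = cong ⁇_ (psub-cong e F)
  psub-cong e (! F)       = cong !_ (psub-cong e F)
  psub-cong e (F ∧ G)     = cong₂ _∧_ (psub-cong e F) (psub-cong e G)
  psub-cong e (F ∨ G)     = cong₂ _∨_ (psub-cong e F) (psub-cong e G)
  psub-cong e (F ⟶ G)     = cong₂ _⟶_ (psub-cong e F) (psub-cong e G)
  psub-cong e (Ex F)      = cong Ex (psub-cong e F)
  psub-cong e (All F)     = cong All (psub-cong e F)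

  psub-pren : ∀ {s Δ₀ Δ Δ' n n'} (σ : PSub Δ Δ' n) (θ : Fin n → Fin n') (ρ : Renaming Δ₀ Δ)
              (F : Fm s Δ₀ n') → psub σ θ (pren ρ F) ≡ psub (σ ∘ ρ) θ F
  psub-pren σ θ ρ ⊤c          = refl
  psub-pren σ θ ρ ⊥c          = refl
  psub-pren σ θ ρ ✓           = refl
  psub-pren σ θ ρ ⋏           = refl
  psub-pren σ θ ρ (atom x ys) = refl
  psub-pren σ θ ρ (⁇ F)       = cong ⁇_ (psub-pren σ θ ρ F)
  psub-pren σ θ ρ (! F)       = cong !_ (psub-pren σ θ ρ F)
  psub-pren σ θ ρ (F ∧ G)     = cong₂ _∧_ (psub-pren σ θ ρ F) (psub-pren σ θ ρ G)
  psub-pren σ θ ρ (F ∨ G)     = cong₂ _∨_ (psub-pren σ θ ρ F) (psub-pren σ θ ρ G)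
  psub-pren σ θ ρ (F ⟶ G)     = cong₂ _⟶_ (psub-pren σ θ ρ F) (psub-pren σ θ ρ G)
  psub-pren σ θ ρ (Ex F)      = cong Ex (psub-pren σ (suc ∘ θ) ρ F)
  psub-pren σ θ ρ (All F)     = cong All (psub-pren σ (suc ∘ θ) ρ F)

  psub-var : ∀ {s Δ Δ' n n'} {σ : PSub Δ Δ' n} (ρ : Renaming Δ Δ') →
             (∀ {κ} (x : Δ ∋ κ) → σ x ≡ atom (ρ x) (argPlaces (proj₂ κ) n)) →
             (θ : Fin n → Fin n') (F : Fm s Δ n') → psub σ θ F ≡ pren ρ F
  psub-var ρ e θ ⊤c                  = refl
  psub-var ρ e θ ⊥c                  = refl
  psub-var ρ e θ ✓                   = refl
  psub-var ρ e θ ⋏                   = refl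
  psub-var ρ e θ (atom {κ = κ} x ys) =
    trans (cong (ren _) (e x)) (cong (atom (ρ x)) (map-[lookup,θ]-argPlaces (proj₂ κ) ys θ))
  psub-var ρ e θ (⁇ F)               = cong ⁇_ (psub-var ρ e θ F)
  psub-var ρ e θ (! F)               = cong !_ (psub-var ρ e θ F)
  psub-var ρ e θ (F ∧ G)             = cong₂ _∧_ (psub-var ρ e θ F) (psub-var ρ e θ G)
  psub-var ρ e θ (F ∨ G)             = cong₂ _∨_ (psub-var ρ e θ F) (psub-var ρ e θ G)
  psub-var ρ e θ (F ⟶ G)             = cong₂ _⟶_ (psub-var ρ e θ F) (psub-var ρ e θ G)
  psub-var ρ e θ (Ex F)              = cong Ex (psub-var ρ e (suc ∘ θ) F)
  psub-var ρ e θ (All F)             = cong All (psub-var ρ e (suc ∘ θ) F)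

  laws : SyntaxLaws syn
  laws = record { ren-id = ren-id ; pren-cong = pren-cong ; pren-patom = λ _ _ _ → refl ; pren-id = pren-id
                ; psub-cong = psub-cong ; psub-pren = psub-pren ; psub-var = psub-var }

module Meta (L : Syntax) where
  open Syntax L
  open Framework L

  weaken : ∀ {Δ n} {Γ Γ' : List (MF Δ n)} {M} → Renaming Γ Γ' → Γ ⊢ M → Γ' ⊢ M
  weaken ⊆ (hyp x)      = hyp (⊆ x)
  weaken ⊆ (&I d e)     = &I (weaken ⊆ d) (weaken ⊆ e)
  weaken ⊆ (&E₁ d)      = &E₁ (weaken ⊆ d)
  weaken ⊆ (&E₂ d)      = &E₂ (weaken ⊆ d)
  weaken ⊆ (⇛I d)       = ⇛I (weaken (λ { here → here ; (there x) → there (⊆ x) }) d)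
  weaken ⊆ (⇛E d e)     = ⇛E (weaken ⊆ d) (weaken ⊆ e)
  weaken ⊆ (∀¹I d)      = ∀¹I (weaken (map-⊆ wk¹ ⊆) d)
  weaken ⊆ (∀¹E d x)    = ∀¹E (weaken ⊆ d) x
  weaken ⊆ (∀²I d)      = ∀²I (weaken (map-⊆ wk² ⊆) d)
  weaken ⊆ (∀²E d φ)    = ∀²E (weaken ⊆ d) φ
  weaken ⊆ (fresh¹ d)   = fresh¹ (weaken (map-⊆ wk¹ ⊆) d)
  weaken ⊆ (fresh² κ d) = fresh² κ (weaken (map-⊆ wk² ⊆) d)

  ⇛-trans : ∀ {M N K : MF [] 0} → [] ⊢ M ⇛ N → [] ⊢ N ⇛ K → [] ⊢ M ⇛ K
  ⇛-trans d e = ⇛I (⇛E (weaken (λ ()) e) (⇛E (weaken (λ ()) d) (hyp here)))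

  -- For a concrete closed D, lift₀ D is unchanged by wk¹ and wk² up to computation, so a
  -- hypothesis Γ ∋ lift₀ D stays usable under every binder of a derivation.
  lift₀ : ∀ {Δ n} → MF [] 0 → MF Δ n
  lift₀ = prenM (λ ()) ∘ renM (λ ())

  conjunct : ∀ {Δ n} {Γ : List (MF Δ n)} {M Ms} (i : Fin (suc (length Ms))) →
             Γ ⊢ lift₀ (bigAnd M Ms) → Γ ⊢ lift₀ (lookupL (M ∷ Ms) i)
  conjunct {Ms = []}    zero    d = d
  conjunct {Ms = _ ∷ _} zero    d = &E₁ d
  conjunct {Ms = M' ∷ Ms} (suc i) d = conjunct {M = M'} {Ms} i (&E₂ d)

  bigAnd-intro : ∀ {Δ n} {Γ : List (MF Δ n)} {M Ms} → Γ ⊢ M → All.All (Γ ⊢_) Ms → Γ ⊢ bigAnd M Ms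
  bigAnd-intro d []       = d
  bigAnd-intro d (e ∷ es) = &I d (bigAnd-intro e es)

  bigAnd-elim : ∀ {Δ n} {Γ : List (MF Δ n)} M Ms → Γ ⊢ bigAnd M Ms → All.All (Γ ⊢_) (M ∷ Ms)
  bigAnd-elim M []       d = d ∷ []
  bigAnd-elim M (N ∷ Ns) d = &E₁ d ∷ bigAnd-elim N Ns (&E₂ d)

  module Lawful (laws : SyntaxLaws L) where
    open SyntaxLaws laws

    extσ-cong : ∀ {Δ Δ' n κ'} {σ σ' : PSub Δ Δ' n} → (∀ {κ} (x : Δ ∋ κ) → σ x ≡ σ' x) →
                ∀ {κ} (x : (κ' ∷ Δ) ∋ κ) → extσ σ x ≡ extσ σ' x
    extσ-cong e here      = refl
    extσ-cong e (there x) = cong (pren there) (e x)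

    prenM-cong : ∀ {Δ Δ' n} {ρ ρ' : Renaming Δ Δ'} → (∀ {κ} (x : Δ ∋ κ) → ρ x ≡ ρ' x) →
                 (M : MF Δ n) → prenM ρ M ≡ prenM ρ' M
    prenM-cong e (fml F)  = cong fml (pren-cong e F)
    prenM-cong e (M & N)  = cong₂ _&_ (prenM-cong e M) (prenM-cong e N)
    prenM-cong e (M ⇛ N)  = cong₂ _⇛_ (prenM-cong e M) (prenM-cong e N)
    prenM-cong e (∀¹ M)   = cong ∀¹ (prenM-cong e M)
    prenM-cong e (∀² κ M) = cong (∀² κ) (prenM-cong (λ { here → refl ; (there x) → cong there (e x) }) M)

    prenM-id : ∀ {Δ n} {ρ : Renaming Δ Δ} → (∀ {κ} (x : Δ ∋ κ) → ρ x ≡ x) →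
               (M : MF Δ n) → prenM ρ M ≡ M
    prenM-id e (fml F)  = cong fml (pren-id e F)
    prenM-id e (M & N)  = cong₂ _&_ (prenM-id e M) (prenM-id e N)
    prenM-id e (M ⇛ N)  = cong₂ _⇛_ (prenM-id e M) (prenM-id e N)
    prenM-id e (∀¹ M)   = cong ∀¹ (prenM-id e M)
    prenM-id e (∀² κ M) = cong (∀² κ) (prenM-id (λ { here → refl ; (there x) → cong there (e x) }) M)

    psubM-cong : ∀ {Δ Δ' n n'} {σ σ' : PSub Δ Δ' n} {θ : Fin n → Fin n'} →
                 (∀ {κ} (x : Δ ∋ κ) → σ x ≡ σ' x) → (M : MF Δ n') → psubM σ θ M ≡ psubM σ' θ M
    psubM-cong e (fml F)  = cong fml (psub-cong e F)
    psubM-cong e (M & N)  = cong₂ _&_ (psubM-cong e M) (psubM-cong e N)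
    psubM-cong e (M ⇛ N)  = cong₂ _⇛_ (psubM-cong e M) (psubM-cong e N)
    psubM-cong e (∀¹ M)   = cong ∀¹ (psubM-cong e M)
    psubM-cong e (∀² κ M) = cong (∀² κ) (psubM-cong (extσ-cong e) M)

    psub-pren-var : ∀ {s Δ₀ Δ Δ' n n'} {σ : PSub Δ Δ' n} (θ : Fin n → Fin n')
                    (ρ : Renaming Δ₀ Δ) (ρ' : Renaming Δ₀ Δ') →
                    (∀ {κ} (x : Δ₀ ∋ κ) → σ (ρ x) ≡ patom (ρ' x) (argPlaces (proj₂ κ) n)) →
                    (F : Fm s Δ₀ n') → psub σ θ (pren ρ F) ≡ pren ρ' F
    psub-pren-var {σ = σ} θ ρ ρ' e F = trans (psub-pren σ θ ρ F) (psub-var ρ' e θ F)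

    instSub : ∀ {Δ n κ} → Fm (proj₁ κ) Δ (proj₂ κ + n) → PSub (κ ∷ Δ) Δ n
    instSub     φ here      = φ
    instSub {n = n} φ (there x) = patom x (argPlaces _ n)

    ∀²E′ : ∀ {Δ n κ} {Γ : List (MF Δ n)} {M} → Γ ⊢ ∀² κ M → (φ : Fm (proj₁ κ) Δ (proj₂ κ + n)) →
           Γ ⊢ psubM (instSub φ) id M
    ∀²E′ {M = M} d φ = subst (_ ⊢_) (psubM-cong (λ { here → refl ; (there _) → refl }) M) (∀²E d φ)

    -- ∀²E leaves the renaming place₀ around every formula it substitutes for a 0-ary
    -- variable; it is the identity only pointwise, and schema₁₂₃ below remove it.
    place₀ : ∀ {n} → Fin n → Fin n
    place₀ {n} = [ lookup {A = Fin n} [] , id ]′ ∘ splitAt 0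

    inst-#0 : ∀ {s Δ n} (A : Fm s Δ n) → ren place₀ A ≡ A
    inst-#0 = ren-id (λ _ → refl)

    psub-instSub-wk : ∀ {s s' Δ n n'} {A : Fm s' Δ n} {θ : Fin n → Fin n'} (B : Fm s Δ n') →
                      psub (instSub A) θ (pren there B) ≡ B
    psub-instSub-wk {θ = θ} B = trans (psub-pren-var θ there id (λ _ → refl) B) (pren-id (λ _ → refl) B)

    inst-#1 : ∀ {s s' Δ n} {A : Fm s' Δ n} (B : Fm s Δ n) →
              psub (instSub A) id (ren place₀ (pren there B)) ≡ B
    inst-#1 {A = A} B = trans (cong (psub (instSub A) id) (inst-#0 (pren there B))) (psub-instSub-wk B)

    inst-#2 : ∀ {s s' s'' Δ n} {A : Fm s' Δ n} {B : Fm s'' Δ n} (C : Fm s Δ n) →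
              psub (instSub A) id (psub (extσ (instSub B)) id (ren place₀ (pren there (pren there C)))) ≡ C
    inst-#2 {A = A} {B} C = begin
      psub (instSub A) id (psub (extσ (instSub B)) id (ren place₀ (pren there (pren there C))))
        ≡⟨ cong (psub (instSub A) id ∘ psub (extσ (instSub B)) id) (inst-#0 (pren there (pren there C))) ⟩
      psub (instSub A) id (psub (extσ (instSub B)) id (pren there (pren there C)))
        ≡⟨ cong (psub (instSub A) id) (psub-pren _ id there (pren there C)) ⟩
      psub (instSub A) id (psub (extσ (instSub B) ∘ there) id (pren there C))
        ≡⟨ cong (psub (instSub A) id) (psub-pren-var id there there (λ x → pren-patom there x _) C) ⟩
      psub (instSub A) id (pren there C)
        ≡⟨ psub-instSub-wk C ⟩
      C ∎
      where open ≡-Reasoning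

    ∀²E₂ : ∀ {Δ n κ κ'} {Γ : List (MF Δ n)} {M} → Γ ⊢ ∀² κ' (∀² κ M) →
           (φ : Fm (proj₁ κ) Δ (proj₂ κ + n)) (ψ : Fm (proj₁ κ') Δ (proj₂ κ' + n)) →
           Γ ⊢ psubM (instSub φ) id (psubM (extσ (instSub ψ)) id M)
    ∀²E₂ d φ ψ = ∀²E′ (∀²E′ d ψ) φ

    ∀²E₃ : ∀ {Δ n κ κ' κ''} {Γ : List (MF Δ n)} {M} → Γ ⊢ ∀² κ'' (∀² κ' (∀² κ M)) →
           (φ : Fm (proj₁ κ) Δ (proj₂ κ + n)) (ψ : Fm (proj₁ κ') Δ (proj₂ κ' + n))
           (χ : Fm (proj₁ κ'') Δ (proj₂ κ'' + n)) →
           Γ ⊢ psubM (instSub φ) id (psubM (extσ (instSub ψ)) id (psubM (extσ (extσ (instSub χ))) id M))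
    ∀²E₃ d φ ψ χ = ∀²E′ (∀²E′ (∀²E′ d χ) ψ) φ

    module _ {Δ n} {Γ : List (MF Δ n)} where

      schema₁ : ∀ {s} (S : Fm s Δ n → MF Δ n) {A} → Γ ⊢ S (ren place₀ A) → Γ ⊢ S A
      schema₁ S {A} = subst (λ a → Γ ⊢ S a) (inst-#0 A)

      schema₂ : ∀ {s s'} (S : Fm s Δ n → Fm s' Δ n → MF Δ n) {A B} →
              Γ ⊢ S (ren place₀ A) (psub (instSub A) id (ren place₀ (pren there B))) → Γ ⊢ S A B
      schema₂ S {A} {B} = subst₂ (λ a b → Γ ⊢ S a b) (inst-#0 A) (inst-#1 B)

      schema₃ : ∀ {s s' s''} (S : Fm s Δ n → Fm s' Δ n → Fm s'' Δ n → MF Δ n) {A B C} →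
              Γ ⊢ S (ren place₀ A) (psub (instSub A) id (ren place₀ (pren there B)))
                    (psub (instSub A) id (psub (extσ (instSub B)) id (ren place₀ (pren there (pren there C))))) →
              Γ ⊢ S A B C
      schema₃ {s'' = s''} S {A} {B} {C} d =
        subst (λ c → Γ ⊢ S A B c) (inst-#2 {A = A} {B} C)
              (subst₂ (λ a b → Γ ⊢ S a b C') (inst-#0 A) (inst-#1 B) d)
        where
        C' : Fm s'' Δ n
        C' = psub (instSub A) id (psub (extσ (instSub B)) id (ren place₀ (pren there (pren there C))))

module Lift (A B : Syntax) (lawsB : SyntaxLaws B) (fs : Syntax.Sort A → Syntax.Sort B) where
  private
    module A  = Syntax A
    module B  = Syntax B
    module FA = Framework A
    module FB = Framework B
  open SyntaxLaws lawsB using (pren-cong; psub-cong)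
  open Meta.Lawful B lawsB using (prenM-cong; psubM-cong)

  mapκ : A.Sort × ℕ → B.Sort × ℕ
  mapκ (s , k) = fs s , k

  mapCtx : List (A.Sort × ℕ) → List (B.Sort × ℕ)
  mapCtx = lmap mapκ

  mapVar : ∀ {Δ κ} → Δ ∋ κ → mapCtx Δ ∋ mapκ κ
  mapVar here      = here
  mapVar (there x) = there (mapVar x)

  mapRen : ∀ {Δ Δ'} → Renaming Δ Δ' → Renaming (mapCtx Δ) (mapCtx Δ')
  mapRen {_ ∷ _} ρ here      = mapVar (ρ here)
  mapRen {_ ∷ _} ρ (there y) = mapRen (ρ ∘ there) y

  mapRen-mapVar : ∀ {Δ Δ' κ} (ρ : Renaming Δ Δ') (x : Δ ∋ κ) → mapRen ρ (mapVar x) ≡ mapVar (ρ x)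
  mapRen-mapVar ρ here      = refl
  mapRen-mapVar ρ (there x) = mapRen-mapVar (ρ ∘ there) x

  mapRen-there : ∀ {Δ Δ' κ'} (ρ : Renaming Δ Δ') → ∀ {κ} (y : mapCtx Δ ∋ κ) →
                 mapRen {Δ' = κ' ∷ Δ'} (there ∘ ρ) y ≡ there (mapRen ρ y)
  mapRen-there {_ ∷ _} ρ here      = refl
  mapRen-there {_ ∷ _} ρ (there y) = mapRen-there (ρ ∘ there) y

  mapRen-id : ∀ {Δ κ} (y : mapCtx Δ ∋ κ) → mapRen id y ≡ y
  mapRen-id {_ ∷ _} here      = refl
  mapRen-id {_ ∷ Δ} (there y) = trans (mapRen-there {Δ} id y) (cong there (mapRen-id y))

  mapRen-wk : ∀ {Δ κ'} → ∀ {κ} (y : mapCtx Δ ∋ κ) → mapRen {Δ' = κ' ∷ Δ} there y ≡ there y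
  mapRen-wk y = trans (mapRen-there id y) (cong there (mapRen-id y))

  mapRen-liftV : ∀ {Δ Δ' κ'} (ρ : Renaming Δ Δ') → ∀ {κ} (y : mapCtx (κ' ∷ Δ) ∋ κ) →
                 mapRen (liftV ρ) y ≡ liftV (mapRen ρ) y
  mapRen-liftV ρ here      = refl
  mapRen-liftV ρ (there y) = mapRen-there ρ y

  FormulaMap : Set
  FormulaMap = ∀ {s Δ n} → A.Fm s Δ n → B.Fm (fs s) (mapCtx Δ) n

  mapSub : ∀ {Δ Δ' n} → FormulaMap → FA.PSub Δ Δ' n → FB.PSub (mapCtx Δ) (mapCtx Δ') n
  mapSub {_ ∷ _} T' σ here      = T' (σ here)
  mapSub {_ ∷ _} T' σ (there y) = mapSub T' (σ ∘ there) y

  mapSub-mapVar : ∀ {Δ Δ' n κ} (T' : FormulaMap) (σ : FA.PSub Δ Δ' n) (x : Δ ∋ κ) →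
                  mapSub T' σ (mapVar x) ≡ T' (σ x)
  mapSub-mapVar T' σ here      = refl
  mapSub-mapVar T' σ (there x) = mapSub-mapVar T' (σ ∘ there) x

  -- T' translates the formulas substituted for predicate variables; it differs from T when
  -- T does not send atoms to atoms (under erasure, problem variables become □-atoms).
  record SyntaxMap : Set where
    field
      T       : FormulaMap
      T'      : FormulaMap
      T-ren   : ∀ {s Δ n m} (f : Fin n → Fin m) (F : A.Fm s Δ n) → T (A.ren f F) ≡ B.ren f (T F)
      T-pren  : ∀ {s Δ Δ' n} (ρ : Renaming Δ Δ') (F : A.Fm s Δ n) → T (A.pren ρ F) ≡ B.pren (mapRen ρ) (T F)
      T'-pren : ∀ {s Δ Δ' n} (ρ : Renaming Δ Δ') (F : A.Fm s Δ n) → T' (A.pren ρ F) ≡ B.pren (mapRen ρ) (T' F)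
      T-psub  : ∀ {s Δ Δ' n n'} (σ : FA.PSub Δ Δ' n) (θ : Fin n → Fin n') (F : A.Fm s Δ n') →
                T (A.psub σ θ F) ≡ B.psub (mapSub T' σ) θ (T F)
      T'-atom : ∀ {Δ n κ} (x : Δ ∋ κ) (ys : Vec (Fin n) (proj₂ κ)) → T' (A.patom x ys) ≡ B.patom (mapVar x) ys

  module Lifting (tr : SyntaxMap) where
    open SyntaxMap tr

    translateM : ∀ {Δ n} → FA.MF Δ n → FB.MF (mapCtx Δ) n
    translateM (FA.fml F)  = FB.fml (T F)
    translateM (M FA.& N)  = translateM M FB.& translateM N
    translateM (M FA.⇛ N)  = translateM M FB.⇛ translateM N
    translateM (FA.∀¹ M)   = FB.∀¹ (translateM M)
    translateM (FA.∀² κ M) = FB.∀² (mapκ κ) (translateM M)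

    translateM-ren : ∀ {Δ n m} (f : Fin n → Fin m) (M : FA.MF Δ n) →
                     translateM (FA.renM f M) ≡ FB.renM f (translateM M)
    translateM-ren f (FA.fml F)  = cong FB.fml (T-ren f F)
    translateM-ren f (M FA.& N)  = cong₂ FB._&_ (translateM-ren f M) (translateM-ren f N)
    translateM-ren f (M FA.⇛ N)  = cong₂ FB._⇛_ (translateM-ren f M) (translateM-ren f N)
    translateM-ren f (FA.∀¹ M)   = cong FB.∀¹ (translateM-ren (liftF f) M)
    translateM-ren f (FA.∀² κ M) = cong (FB.∀² (mapκ κ)) (translateM-ren f M)

    translateM-pren : ∀ {Δ Δ' n} (ρ : Renaming Δ Δ') (M : FA.MF Δ n) →
                      translateM (FA.prenM ρ M) ≡ FB.prenM (mapRen ρ) (translateM M)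
    translateM-pren ρ (FA.fml F)  = cong FB.fml (T-pren ρ F)
    translateM-pren ρ (M FA.& N)  = cong₂ FB._&_ (translateM-pren ρ M) (translateM-pren ρ N)
    translateM-pren ρ (M FA.⇛ N)  = cong₂ FB._⇛_ (translateM-pren ρ M) (translateM-pren ρ N)
    translateM-pren ρ (FA.∀¹ M)   = cong FB.∀¹ (translateM-pren ρ M)
    translateM-pren ρ (FA.∀² κ M) = cong (FB.∀² (mapκ κ))
      (trans (translateM-pren (liftV ρ) M) (prenM-cong (mapRen-liftV ρ) (translateM M)))

    translateM-wk² : ∀ {Δ n κ} (M : FA.MF Δ n) → translateM (FA.wk² {κ = κ} M) ≡ FB.wk² (translateM M)
    translateM-wk² M = trans (translateM-pren there M) (prenM-cong mapRen-wk (translateM M))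

    mapSub-pren : ∀ {Δ Δ' Δ'' n} (ρ : Renaming Δ' Δ'') (σ : FA.PSub Δ Δ' n) →
                  ∀ {κ} (y : mapCtx Δ ∋ κ) → mapSub T' (A.pren ρ ∘ σ) y ≡ B.pren (mapRen ρ) (mapSub T' σ y)
    mapSub-pren {_ ∷ _} ρ σ here      = T'-pren ρ (σ here)
    mapSub-pren {_ ∷ _} ρ σ (there y) = mapSub-pren ρ (σ ∘ there) y

    mapSub-extσ : ∀ {Δ Δ' n κ'} (σ : FA.PSub Δ Δ' n) → ∀ {κ} (y : mapCtx (κ' ∷ Δ) ∋ κ) →
                  mapSub T' (FA.extσ {κ' = κ'} σ) y ≡ FB.extσ (mapSub T' σ) y
    mapSub-extσ σ here      = T'-atom here _
    mapSub-extσ σ (there y) = trans (mapSub-pren there σ y) (pren-cong mapRen-wk (mapSub T' σ y))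

    translateM-psub : ∀ {Δ Δ' n n'} (σ : FA.PSub Δ Δ' n) (θ : Fin n → Fin n') (M : FA.MF Δ n') →
                      translateM (FA.psubM σ θ M) ≡ FB.psubM (mapSub T' σ) θ (translateM M)
    translateM-psub σ θ (FA.fml F)  = cong FB.fml (T-psub σ θ F)
    translateM-psub σ θ (M FA.& N)  = cong₂ FB._&_ (translateM-psub σ θ M) (translateM-psub σ θ N)
    translateM-psub σ θ (M FA.⇛ N)  = cong₂ FB._⇛_ (translateM-psub σ θ M) (translateM-psub σ θ N)
    translateM-psub σ θ (FA.∀¹ M)   = cong FB.∀¹ (translateM-psub σ (suc ∘ θ) M)
    translateM-psub σ θ (FA.∀² κ M) = cong (FB.∀² (mapκ κ))
      (trans (translateM-psub (FA.extσ σ) θ M) (psubM-cong (mapSub-extσ σ) (translateM M)))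

    mapSub-atoms : ∀ {Δ Δ' n} (ρ : Renaming Δ Δ') → ∀ {κ} (y : mapCtx Δ ∋ κ) →
                   mapSub T' (λ x → A.patom (ρ x) (argPlaces _ n)) y ≡ B.patom (mapRen ρ y) (argPlaces _ n)
    mapSub-atoms {_ ∷ _} ρ here      = T'-atom (ρ here) _
    mapSub-atoms {_ ∷ _} ρ (there y) = mapSub-atoms (ρ ∘ there) y

    translateM-inst² : ∀ {Δ n κ} (φ : A.Fm (proj₁ κ) Δ (proj₂ κ + n)) (M : FA.MF (κ ∷ Δ) n) →
                       translateM (FA.inst² φ M) ≡ FB.inst² (T' φ) (translateM M)
    translateM-inst² {n = n} φ M = trans (translateM-psub _ id M) (psubM-cong agree (translateM M))
      where
      agree : ∀ {κ} (y : mapCtx _ ∋ κ) → mapSub T' _ y ≡ _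
      agree here      = refl
      agree (there y) = trans (mapSub-atoms id y) (cong (λ z → B.patom z (argPlaces _ n)) (mapRen-id y))

    map-translateM-wk¹ : ∀ {Δ n} (Γ : List (FA.MF Δ n)) →
                         lmap translateM (lmap FA.wk¹ Γ) ≡ lmap FB.wk¹ (lmap translateM Γ)
    map-translateM-wk¹ []      = refl
    map-translateM-wk¹ (M ∷ Γ) = cong₂ _∷_ (translateM-ren suc M) (map-translateM-wk¹ Γ)

    map-translateM-wk² : ∀ {Δ n κ} (Γ : List (FA.MF Δ n)) →
                         lmap translateM (lmap (FA.wk² {κ = κ}) Γ) ≡ lmap FB.wk² (lmap translateM Γ)
    map-translateM-wk² []      = refl
    map-translateM-wk² (M ∷ Γ) = cong₂ _∷_ (translateM-wk² M) (map-translateM-wk² Γ)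

    translate⊢ : ∀ {Δ n} {Γ : List (FA.MF Δ n)} {M} → Γ FA.⊢ M → lmap translateM Γ FB.⊢ translateM M
    translate⊢ (FA.hyp x)   = FB.hyp (map-∋ translateM x)
    translate⊢ (FA.&I d e)  = FB.&I (translate⊢ d) (translate⊢ e)
    translate⊢ (FA.&E₁ d)   = FB.&E₁ (translate⊢ d)
    translate⊢ (FA.&E₂ d)   = FB.&E₂ (translate⊢ d)
    translate⊢ (FA.⇛I d)    = FB.⇛I (translate⊢ d)
    translate⊢ (FA.⇛E d e)  = FB.⇛E (translate⊢ d) (translate⊢ e)
    translate⊢ {Γ = Γ} (FA.∀¹I d) = FB.∀¹I (subst (FB._⊢ _) (map-translateM-wk¹ Γ) (translate⊢ d))
    translate⊢ (FA.∀¹E {M = M} d x) =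
      subst (_ FB.⊢_) (sym (translateM-ren _ M)) (FB.∀¹E (translate⊢ d) x)
    translate⊢ {Γ = Γ} (FA.∀²I d) = FB.∀²I (subst (FB._⊢ _) (map-translateM-wk² Γ) (translate⊢ d))
    translate⊢ (FA.∀²E {M = M} d φ) =
      subst (_ FB.⊢_) (sym (translateM-inst² φ M)) (FB.∀²E (translate⊢ d) (T' φ))
    translate⊢ {Γ = Γ} (FA.fresh¹ {M = M} d) =
      FB.fresh¹ (subst₂ FB._⊢_ (map-translateM-wk¹ Γ) (translateM-ren suc M) (translate⊢ d))
    translate⊢ {Γ = Γ} (FA.fresh² {M = M} κ d) =
      FB.fresh² (mapκ κ) (subst₂ FB._⊢_ (map-translateM-wk² Γ) (translateM-wk² M) (translate⊢ d))

module Implication {F : Set} (_⟶_ : F → F → F) (Thm : F → Set)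
  (mp  : ∀ {A B} → Thm (A ⟶ B) → Thm A → Thm B)
  (axK : ∀ A B → Thm (A ⟶ (B ⟶ A)))
  (axS : ∀ A B C → Thm ((A ⟶ (B ⟶ C)) ⟶ ((A ⟶ B) ⟶ (A ⟶ C))))
  where

  ⟶-refl : ∀ A → Thm (A ⟶ A)
  ⟶-refl A = mp (mp (axS A (A ⟶ A) A) (axK A (A ⟶ A))) (axK A A)

  ⟶-trans : ∀ {A B C} → Thm (A ⟶ B) → Thm (B ⟶ C) → Thm (A ⟶ C)
  ⟶-trans {A} {B} {C} f g = mp (mp (axS A B C) (mp (axK (B ⟶ C) A) g)) f

module BoxedDeduction {F : Set} (_⟶_ : F → F → F) (□_ : F → F) (Thm : F → Set)
  (mp   : ∀ {A B} → Thm (A ⟶ B) → Thm A → Thm B)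
  (axK  : ∀ A B → Thm (A ⟶ (B ⟶ A)))
  (axS  : ∀ A B C → Thm ((A ⟶ (B ⟶ C)) ⟶ ((A ⟶ B) ⟶ (A ⟶ C))))
  (nec  : ∀ {A} → Thm A → Thm (□ A))
  (ax□K : ∀ A B → Thm ((□ (A ⟶ B)) ⟶ ((□ A) ⟶ (□ B))))
  (ax4  : ∀ A → Thm ((□ A) ⟶ (□ (□ A))))
  where

  open Implication _⟶_ Thm mp axK axS public

  infix 3 _⊩_

  data Boxed : F → Set where
    boxed : ∀ A → Boxed (□ A)

  data _⊩_ (Hs : List F) : F → Set where
    hyp  : ∀ {A} → Hs ∋ A → Hs ⊩ A
    mp⊩  : ∀ {A B} → Hs ⊩ A ⟶ B → Hs ⊩ A → Hs ⊩ B
    thm  : ∀ {A} → Thm A → Hs ⊩ A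
    nec⊩ : ∀ {A} → All.All Boxed Hs → Hs ⊩ A → Hs ⊩ □ A

  sound : ∀ {A} → [] ⊩ A → Thm A
  sound (hyp ())
  sound (mp⊩ p q)  = mp (sound p) (sound q)
  sound (thm t)    = t
  sound (nec⊩ _ p) = nec (sound p)

  const⊩ : ∀ {Hs A B} → Hs ⊩ B → Hs ⊩ A ⟶ B
  const⊩ {A = A} {B} p = mp⊩ (thm (axK B A)) p

  -- A boxed hypothesis may be discharged past necessitation thanks to axiom 4.
  deduction : ∀ {Hs A B} → A ∷ Hs ⊩ B → Hs ⊩ A ⟶ B
  deduction {A = A} (hyp here)      = thm (⟶-refl A)
  deduction         (hyp (there x)) = const⊩ (hyp x)
  deduction {A = A} (mp⊩ {B} {C} p q) = mp⊩ (mp⊩ (thm (axS A B C)) (deduction p)) (deduction q)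
  deduction         (thm t)         = const⊩ (thm t)
  deduction (nec⊩ {B} (boxed X ∷ hs) p) =
    mp⊩ (mp⊩ (thm (axS (□ X) (□ □ X) (□ B)))
             (const⊩ (mp⊩ (thm (ax□K (□ X) B)) (nec⊩ hs (deduction p)))))
        (thm (ax4 X))

module Embedding where
  open Lift QS5.syn QHC.syn QHCLaws.laws (λ _ → QHC.cl) public
  open QS5
  open Translation using (tr; trVar; trM)
  private module H = QHC

  trVar≡mapVar : ∀ {Δ κ} (x : Δ ∋ κ) → trVar x ≡ mapVar x
  trVar≡mapVar here      = refl
  trVar≡mapVar (there x) = cong there (trVar≡mapVar x)

  tr-ren : ∀ {s Δ n m} (f : Fin n → Fin m) (F : Fm s Δ n) → tr (ren f F) ≡ H.ren f (tr F)
  tr-ren f ⊤c          = refl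
  tr-ren f ⊥c          = refl
  tr-ren f (atom x ys) = refl
  tr-ren f (□ F)       = cong (H.⁇_ ∘ H.!_) (tr-ren f F)
  tr-ren f (F ∧ G)     = cong₂ H._∧_ (tr-ren f F) (tr-ren f G)
  tr-ren f (F ∨ G)     = cong₂ H._∨_ (tr-ren f F) (tr-ren f G)
  tr-ren f (F ⟶ G)     = cong₂ H._⟶_ (tr-ren f F) (tr-ren f G)
  tr-ren f (Ex F)      = cong H.Ex (tr-ren (liftF f) F)
  tr-ren f (All F)     = cong H.All (tr-ren (liftF f) F)

  tr-pren : ∀ {s Δ Δ' n} (ρ : Renaming Δ Δ') (F : Fm s Δ n) → tr (pren ρ F) ≡ H.pren (mapRen ρ) (tr F)
  tr-pren ρ ⊤c          = refl
  tr-pren ρ ⊥c          = refl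
  tr-pren ρ (atom x ys) = cong (λ z → H.atom z ys) (begin
    trVar (ρ x)             ≡⟨ trVar≡mapVar (ρ x) ⟩
    mapVar (ρ x)            ≡⟨ mapRen-mapVar ρ x ⟨
    mapRen ρ (mapVar x)     ≡⟨ cong (mapRen ρ) (trVar≡mapVar x) ⟨
    mapRen ρ (trVar x)      ∎)
    where open ≡-Reasoning
  tr-pren ρ (□ F)       = cong (H.⁇_ ∘ H.!_) (tr-pren ρ F)
  tr-pren ρ (F ∧ G)     = cong₂ H._∧_ (tr-pren ρ F) (tr-pren ρ G)
  tr-pren ρ (F ∨ G)     = cong₂ H._∨_ (tr-pren ρ F) (tr-pren ρ G)
  tr-pren ρ (F ⟶ G)     = cong₂ H._⟶_ (tr-pren ρ F) (tr-pren ρ G)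
  tr-pren ρ (Ex F)      = cong H.Ex (tr-pren ρ F)
  tr-pren ρ (All F)     = cong H.All (tr-pren ρ F)

  tr-psub : ∀ {s Δ Δ' n n'} (σ : PSub Δ Δ' n) (θ : Fin n → Fin n') (F : Fm s Δ n') →
            tr (psub σ θ F) ≡ H.psub (mapSub tr σ) θ (tr F)
  tr-psub σ θ ⊤c          = refl
  tr-psub σ θ ⊥c          = refl
  tr-psub σ θ (atom x ys) = trans (tr-ren _ (σ x))
    (cong (H.ren _) (sym (trans (cong (mapSub tr σ) (trVar≡mapVar x)) (mapSub-mapVar tr σ x))))
  tr-psub σ θ (□ F)       = cong (H.⁇_ ∘ H.!_) (tr-psub σ θ F)
  tr-psub σ θ (F ∧ G)     = cong₂ H._∧_ (tr-psub σ θ F) (tr-psub σ θ G)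
  tr-psub σ θ (F ∨ G)     = cong₂ H._∨_ (tr-psub σ θ F) (tr-psub σ θ G)
  tr-psub σ θ (F ⟶ G)     = cong₂ H._⟶_ (tr-psub σ θ F) (tr-psub σ θ G)
  tr-psub σ θ (Ex F)      = cong H.Ex (tr-psub σ (suc ∘ θ) F)
  tr-psub σ θ (All F)     = cong H.All (tr-psub σ (suc ∘ θ) F)

  embedding : SyntaxMap
  embedding = record
    { T = tr ; T' = tr ; T-ren = tr-ren ; T-pren = tr-pren ; T'-pren = tr-pren ; T-psub = tr-psub
    ; T'-atom = λ x ys → cong (λ z → H.atom z ys) (trVar≡mapVar x) }

  open Lifting embedding public

  translateM≡trM : ∀ {Δ n} (M : MF Δ n) → translateM M ≡ trM M
  translateM≡trM (fml F)  = refl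
  translateM≡trM (M & N)  = cong₂ H._&_ (translateM≡trM M) (translateM≡trM N)
  translateM≡trM (M ⇛ N)  = cong₂ H._⇛_ (translateM≡trM M) (translateM≡trM N)
  translateM≡trM (∀¹ M)   = cong H.∀¹ (translateM≡trM M)
  translateM≡trM (∀² κ M) = cong (H.∀² _) (translateM≡trM M)

module Erasure where
  open Lift QHC.syn QS5.syn QS5Laws.laws (λ _ → QS5.∗) public
  open QHC
  open Translation using (tr; trVar; trM; trCtx)
  private module S = QS5
  open Meta.Lawful S.syn QS5Laws.laws using (prenM-cong; prenM-id)

  mutual
    erase : ∀ {s Δ n} → Fm s Δ n → S.Fm S.∗ (mapCtx Δ) n
    erase ⊤c          = S.⊤c
    erase ⊥c          = S.⊥c
    erase ✓           = S.⊤c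
    erase ⋏           = S.⊥c
    erase (atom x ys) = S.atom (mapVar x) ys
    erase (⁇ F)       = boxed F
    erase (! F)       = boxed F
    erase (F ∧ G)     = boxed F S.∧ boxed G
    erase (F ∨ G)     = boxed F S.∨ boxed G
    erase (F ⟶ G)     = boxed F S.⟶ boxed G
    erase (Ex F)      = S.Ex (boxed F)
    erase (All F)     = S.All (boxed F)

    boxed : ∀ {s Δ n} → Fm s Δ n → S.Fm S.∗ (mapCtx Δ) n
    boxed {cl}  F = erase F
    boxed {int} F = S.□ erase F

  mutual
    erase-ren : ∀ {s Δ n m} (f : Fin n → Fin m) (F : Fm s Δ n) → erase (ren f F) ≡ S.ren f (erase F)
    erase-ren f ⊤c          = refl
    erase-ren f ⊥c          = refl
    erase-ren f ✓           = refl
    erase-ren f ⋏           = refl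
    erase-ren f (atom x ys) = refl
    erase-ren f (⁇ F)       = boxed-ren f F
    erase-ren f (! F)       = boxed-ren f F
    erase-ren f (F ∧ G)     = cong₂ S._∧_ (boxed-ren f F) (boxed-ren f G)
    erase-ren f (F ∨ G)     = cong₂ S._∨_ (boxed-ren f F) (boxed-ren f G)
    erase-ren f (F ⟶ G)     = cong₂ S._⟶_ (boxed-ren f F) (boxed-ren f G)
    erase-ren f (Ex F)      = cong S.Ex (boxed-ren (liftF f) F)
    erase-ren f (All F)     = cong S.All (boxed-ren (liftF f) F)

    boxed-ren : ∀ {s Δ n m} (f : Fin n → Fin m) (F : Fm s Δ n) → boxed (ren f F) ≡ S.ren f (boxed F)
    boxed-ren {cl}  f F = erase-ren f F
    boxed-ren {int} f F = cong S.□_ (erase-ren f F)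

  mutual
    erase-pren : ∀ {s Δ Δ' n} (ρ : Renaming Δ Δ') (F : Fm s Δ n) →
                 erase (pren ρ F) ≡ S.pren (mapRen ρ) (erase F)
    erase-pren ρ ⊤c          = refl
    erase-pren ρ ⊥c          = refl
    erase-pren ρ ✓           = refl
    erase-pren ρ ⋏           = refl
    erase-pren ρ (atom x ys) = cong (λ z → S.atom z ys) (sym (mapRen-mapVar ρ x))
    erase-pren ρ (⁇ F)       = boxed-pren ρ F
    erase-pren ρ (! F)       = boxed-pren ρ F
    erase-pren ρ (F ∧ G)     = cong₂ S._∧_ (boxed-pren ρ F) (boxed-pren ρ G)
    erase-pren ρ (F ∨ G)     = cong₂ S._∨_ (boxed-pren ρ F) (boxed-pren ρ G)
    erase-pren ρ (F ⟶ G)     = cong₂ S._⟶_ (boxed-pren ρ F) (boxed-pren ρ G)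
    erase-pren ρ (Ex F)      = cong S.Ex (boxed-pren ρ F)
    erase-pren ρ (All F)     = cong S.All (boxed-pren ρ F)

    boxed-pren : ∀ {s Δ Δ' n} (ρ : Renaming Δ Δ') (F : Fm s Δ n) →
                 boxed (pren ρ F) ≡ S.pren (mapRen ρ) (boxed F)
    boxed-pren {cl}  ρ F = erase-pren ρ F
    boxed-pren {int} ρ F = cong S.□_ (erase-pren ρ F)

  mutual
    erase-psub : ∀ {s Δ Δ' n n'} (σ : PSub Δ Δ' n) (θ : Fin n → Fin n') (F : Fm s Δ n') →
                 erase (psub σ θ F) ≡ S.psub (mapSub erase σ) θ (erase F)
    erase-psub σ θ ⊤c          = refl
    erase-psub σ θ ⊥c          = refl
    erase-psub σ θ ✓           = refl
    erase-psub σ θ ⋏           = refl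
    erase-psub σ θ (atom x ys) = trans (erase-ren _ (σ x)) (cong (S.ren _) (sym (mapSub-mapVar erase σ x)))
    erase-psub σ θ (⁇ F)       = boxed-psub σ θ F
    erase-psub σ θ (! F)       = boxed-psub σ θ F
    erase-psub σ θ (F ∧ G)     = cong₂ S._∧_ (boxed-psub σ θ F) (boxed-psub σ θ G)
    erase-psub σ θ (F ∨ G)     = cong₂ S._∨_ (boxed-psub σ θ F) (boxed-psub σ θ G)
    erase-psub σ θ (F ⟶ G)     = cong₂ S._⟶_ (boxed-psub σ θ F) (boxed-psub σ θ G)
    erase-psub σ θ (Ex F)      = cong S.Ex (boxed-psub σ (suc ∘ θ) F)
    erase-psub σ θ (All F)     = cong S.All (boxed-psub σ (suc ∘ θ) F)

    boxed-psub : ∀ {s Δ Δ' n n'} (σ : PSub Δ Δ' n) (θ : Fin n → Fin n') (F : Fm s Δ n') →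
                 boxed (psub σ θ F) ≡ S.psub (mapSub erase σ) θ (boxed F)
    boxed-psub {cl}  σ θ F = erase-psub σ θ F
    boxed-psub {int} σ θ F = cong S.□_ (erase-psub σ θ F)

  erasure : SyntaxMap
  erasure = record
    { T = boxed ; T' = erase ; T-ren = boxed-ren ; T-pren = boxed-pren ; T'-pren = erase-pren
    ; T-psub = boxed-psub ; T'-atom = λ x ys → refl }

  open Lifting erasure public

  unmapVar : ∀ {Δ} → Renaming (mapCtx (trCtx Δ)) Δ
  unmapVar {(S.∗ , k) ∷ Δ} here      = here
  unmapVar {(S.∗ , k) ∷ Δ} (there y) = there (unmapVar y)

  unmapVar-mapVar : ∀ {Δ k} (x : Δ ∋ (S.∗ , k)) → unmapVar (mapVar (trVar x)) ≡ x
  unmapVar-mapVar {(S.∗ , k) ∷ Δ} here      = refl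
  unmapVar-mapVar {(S.∗ , k) ∷ Δ} (there x) = cong there (unmapVar-mapVar x)

  boxed∘tr : ∀ {Δ n} (F : S.Fm S.∗ Δ n) → S.pren unmapVar (boxed (tr F)) ≡ F
  boxed∘tr S.⊤c                           = refl
  boxed∘tr S.⊥c                           = refl
  boxed∘tr (S.atom {κ = (S.∗ , k)} x ys)  = cong (λ z → S.atom z ys) (unmapVar-mapVar x)
  boxed∘tr (S.□ F)                        = cong S.□_ (boxed∘tr F)
  boxed∘tr (F S.∧ G)                      = cong₂ S._∧_ (boxed∘tr F) (boxed∘tr G)
  boxed∘tr (F S.∨ G)                      = cong₂ S._∨_ (boxed∘tr F) (boxed∘tr G)
  boxed∘tr (F S.⟶ G)                      = cong₂ S._⟶_ (boxed∘tr F) (boxed∘tr G)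
  boxed∘tr (S.Ex F)                       = cong S.Ex (boxed∘tr F)
  boxed∘tr (S.All F)                      = cong S.All (boxed∘tr F)

  translateM∘trM : ∀ {Δ n} (M : S.MF Δ n) → S.prenM unmapVar (translateM (trM M)) ≡ M
  translateM∘trM (S.fml {S.∗} F) = cong S.fml (boxed∘tr F)
  translateM∘trM (M S.& N)       = cong₂ S._&_ (translateM∘trM M) (translateM∘trM N)
  translateM∘trM (M S.⇛ N)       = cong₂ S._⇛_ (translateM∘trM M) (translateM∘trM N)
  translateM∘trM (S.∀¹ M)        = cong S.∀¹ (translateM∘trM M)
  translateM∘trM (S.∀² (S.∗ , k) M) = cong (S.∀² (S.∗ , k))
    (trans (prenM-cong (λ { here → refl ; (there y) → refl }) (translateM (trM M)))
           (translateM∘trM M))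

  translateM∘trM-closed : (R : S.MF [] 0) → translateM (trM R) ≡ R
  translateM∘trM-closed R = trans (sym (prenM-id (λ ()) (translateM (trM R)))) (translateM∘trM R)

module QS5Reasoning where

  open QS5
  open Meta syn
  open Lawful QS5Laws.laws
  open QS5Laws using (ren-cong; ren-∘; ren-id; ren-sub0-liftF)

  module Theory {Δ n} {Γ : List (MF Δ n)} (D : Γ ∋ lift₀ D-QS5) where

    -- Axiom 0 of D-QS5 is ⊤, 1–16 are the QC axioms and 17–21 the S5 axioms.
    axiom : (i : Fin 22) → Γ ⊢ lift₀ (lookupL (principle [] 0 ⊤c ∷ QCpart ++' S5part) i)
    axiom i = conjunct {M = principle [] 0 ⊤c} {QCpart ++' S5part} i (hyp D)

    axDNE : (A : Fm ∗ Δ n) → Γ ⊢ fml (¬ ¬ A ⟶ A)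
    axDNE A = schema₁ (λ a → fml (¬ ¬ a ⟶ a)) (∀²E′ (axiom (# 1)) A)

    axK : (A B : Fm ∗ Δ n) → Γ ⊢ fml (A ⟶ (B ⟶ A))
    axK A B = schema₂ (λ a b → fml (a ⟶ (b ⟶ a))) (∀²E₂ (axiom (# 2)) A B)

    axS : (A B C : Fm ∗ Δ n) → Γ ⊢ fml ((A ⟶ (B ⟶ C)) ⟶ ((A ⟶ B) ⟶ (A ⟶ C)))
    axS A B C = schema₃ (λ a b c → fml ((a ⟶ (b ⟶ c)) ⟶ ((a ⟶ b) ⟶ (a ⟶ c)))) (∀²E₃ (axiom (# 3)) A B C)

    ax∧₁ : (A B : Fm ∗ Δ n) → Γ ⊢ fml ((A ∧ B) ⟶ A)
    ax∧₁ A B = schema₂ (λ a b → fml ((a ∧ b) ⟶ a)) (∀²E₂ (axiom (# 4)) A B)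

    ax∧₂ : (A B : Fm ∗ Δ n) → Γ ⊢ fml ((A ∧ B) ⟶ B)
    ax∧₂ A B = schema₂ (λ a b → fml ((a ∧ b) ⟶ b)) (∀²E₂ (axiom (# 5)) A B)

    ax∧I : (A B : Fm ∗ Δ n) → Γ ⊢ fml (A ⟶ (B ⟶ (A ∧ B)))
    ax∧I A B = schema₂ (λ a b → fml (a ⟶ (b ⟶ (a ∧ b)))) (∀²E₂ (axiom (# 6)) A B)

    ax∨₁ : (A B : Fm ∗ Δ n) → Γ ⊢ fml (A ⟶ (A ∨ B))
    ax∨₁ A B = schema₂ (λ a b → fml (a ⟶ (a ∨ b))) (∀²E₂ (axiom (# 7)) A B)

    ax∨₂ : (A B : Fm ∗ Δ n) → Γ ⊢ fml (B ⟶ (A ∨ B))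
    ax∨₂ A B = schema₂ (λ a b → fml (b ⟶ (a ∨ b))) (∀²E₂ (axiom (# 8)) A B)

    ax∨E : (A B C : Fm ∗ Δ n) → Γ ⊢ fml ((A ⟶ C) ⟶ ((B ⟶ C) ⟶ ((A ∨ B) ⟶ C)))
    ax∨E A B C = schema₃ (λ a b c → fml ((a ⟶ c) ⟶ ((b ⟶ c) ⟶ ((a ∨ b) ⟶ c)))) (∀²E₃ (axiom (# 9)) A B C)

    ax⊥ : (A : Fm ∗ Δ n) → Γ ⊢ fml (⊥c ⟶ A)
    ax⊥ A = schema₁ (λ a → fml (⊥c ⟶ a)) (∀²E′ (axiom (# 10)) A)

    ax⊤ : Γ ⊢ fml ⊤c
    ax⊤ = axiom (# 11)

    mp : {A B : Fm ∗ Δ n} → Γ ⊢ fml (A ⟶ B) → Γ ⊢ fml A → Γ ⊢ fml B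
    mp {A} {B} ab a = ⇛E (schema₂ (λ a b → (fml a & fml (a ⟶ b)) ⇛ fml b) (∀²E₂ (axiom (# 14)) A B)) (&I a ab)

    axT : (A : Fm ∗ Δ n) → Γ ⊢ fml (□ A ⟶ A)
    axT A = schema₁ (λ a → fml (□ a ⟶ a)) (∀²E′ (axiom (# 17)) A)

    ax4 : (A : Fm ∗ Δ n) → Γ ⊢ fml (□ A ⟶ □ □ A)
    ax4 A = schema₁ (λ a → fml (□ a ⟶ □ □ a)) (∀²E′ (axiom (# 18)) A)

    ax□K : (A B : Fm ∗ Δ n) → Γ ⊢ fml (□ (A ⟶ B) ⟶ (□ A ⟶ □ B))
    ax□K A B = schema₂ (λ a b → fml (□ (a ⟶ b) ⟶ (□ a ⟶ □ b))) (∀²E₂ (axiom (# 19)) A B)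

    ax5 : (A : Fm ∗ Δ n) → Γ ⊢ fml (◇ A ⟶ □ ◇ A)
    ax5 A = schema₁ (λ a → fml (◇ a ⟶ □ ◇ a)) (∀²E′ (axiom (# 20)) A)

    nec : {A : Fm ∗ Δ n} → Γ ⊢ fml A → Γ ⊢ fml (□ A)
    nec {A} = ⇛E (schema₁ (λ a → fml a ⇛ fml (□ a)) (∀²E′ (axiom (# 21)) A))

    ax∀E : (φ : Fm ∗ Δ (suc n)) (y : Fin n) → Γ ⊢ fml (All φ ⟶ ren (sub0 y) φ)
    ax∀E φ y = subst₂ (λ a b → Γ ⊢ fml (All a ⟶ b))
      (trans (ren-∘ _ _ φ) (ren-id (λ { zero → refl ; (suc _) → refl }) φ))
      (trans (ren-∘ _ _ φ) (ren-cong (λ { zero → refl ; (suc _) → refl }) φ))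
      (∀¹E (∀²E′ (axiom (# 12)) φ) y)

    ax∃I : (φ : Fm ∗ Δ (suc n)) (y : Fin n) → Γ ⊢ fml (ren (sub0 y) φ ⟶ Ex φ)
    ax∃I φ y = subst₂ (λ a b → Γ ⊢ fml (a ⟶ Ex b))
      (trans (ren-∘ _ _ φ) (ren-cong (λ { zero → refl ; (suc _) → refl }) φ))
      (trans (ren-∘ _ _ φ) (ren-id (λ { zero → refl ; (suc _) → refl }) φ))
      (∀¹E (∀²E′ (axiom (# 13)) φ) y)

    private
      inst-#1-unary : ∀ {P : Fm ∗ Δ n} (φ : Fm ∗ Δ (suc n)) →
                      psub (instSub P) suc (ren ([ lookup (zero ∷ []) , suc ]′ ∘ splitAt 1) (pren there φ)) ≡ φ
      inst-#1-unary {P} φ =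
        trans (cong (psub (instSub P) suc) (ren-id (λ { zero → refl ; (suc _) → refl }) (pren there φ)))
              (psub-instSub-wk φ)

    genR : {P : Fm ∗ Δ n} {φ : Fm ∗ Δ (suc n)} → Γ ⊢ ∀¹ (fml (ren suc P ⟶ φ)) → Γ ⊢ fml (P ⟶ All φ)
    genR {P} {φ} = ⇛E (subst (λ p → Γ ⊢ ∀¹ (fml (ren suc P ⟶ φ)) ⇛ fml (p ⟶ All φ)) (inst-#0 P)
                         (subst₂ (λ q b → Γ ⊢ ∀¹ (fml (q ⟶ b)) ⇛ fml (ren place₀ P ⟶ All b))
                                 (ren-cong (λ _ → refl) P) (inst-#1-unary φ) (∀²E₂ (axiom (# 15)) P φ)))

    exR : {P : Fm ∗ Δ n} {φ : Fm ∗ Δ (suc n)} → Γ ⊢ ∀¹ (fml (φ ⟶ ren suc P)) → Γ ⊢ fml (Ex φ ⟶ P)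
    exR {P} {φ} = ⇛E (subst (λ p → Γ ⊢ ∀¹ (fml (φ ⟶ ren suc P)) ⇛ fml (Ex φ ⟶ p)) (inst-#0 P)
                        (subst₂ (λ q b → Γ ⊢ ∀¹ (fml (b ⟶ q)) ⇛ fml (Ex b ⟶ ren place₀ P))
                                (ren-cong (λ _ → refl) P) (inst-#1-unary φ) (∀²E₂ (axiom (# 16)) P φ)))

    open BoxedDeduction _⟶_ □_ (λ A → Γ ⊢ fml A) mp axK axS nec ax□K ax4 public

    module _ {Hs : List (Fm ∗ Δ n)} where

      h₀ : ∀ {A} → A ∷ Hs ⊩ A
      h₀ = hyp here

      h₁ : ∀ {A B} → B ∷ A ∷ Hs ⊩ A
      h₁ = hyp (there here)

      h₂ : ∀ {A B C} → C ∷ B ∷ A ∷ Hs ⊩ A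
      h₂ = hyp (there (there here))

      closed⊩ : ∀ {A} → [] ⊩ A → Hs ⊩ A
      closed⊩ = thm ∘ sound

      T⊩ : ∀ {A} → Hs ⊩ □ A → Hs ⊩ A
      T⊩ {A} = mp⊩ (thm (axT A))

      fst⊩ : ∀ {A B} → Hs ⊩ A ∧ B → Hs ⊩ A
      fst⊩ {A} {B} = mp⊩ (thm (ax∧₁ A B))

      snd⊩ : ∀ {A B} → Hs ⊩ A ∧ B → Hs ⊩ B
      snd⊩ {A} {B} = mp⊩ (thm (ax∧₂ A B))

      pair⊩ : ∀ {A B} → Hs ⊩ A → Hs ⊩ B → Hs ⊩ A ∧ B
      pair⊩ {A} {B} p q = mp⊩ (mp⊩ (thm (ax∧I A B)) p) q

      inl⊩ : ∀ {A} B → Hs ⊩ A → Hs ⊩ A ∨ B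
      inl⊩ {A} B = mp⊩ (thm (ax∨₁ A B))

      inr⊩ : ∀ A {B} → Hs ⊩ B → Hs ⊩ A ∨ B
      inr⊩ A {B} = mp⊩ (thm (ax∨₂ A B))

      case⊩ : ∀ {A B C} → Hs ⊩ A ⟶ C → Hs ⊩ B ⟶ C → Hs ⊩ A ∨ B → Hs ⊩ C
      case⊩ {A} {B} {C} f g p = mp⊩ (mp⊩ (mp⊩ (thm (ax∨E A B C)) f) g) p

      exfalso⊩ : ∀ A → Hs ⊩ ⊥c → Hs ⊩ A
      exfalso⊩ A = mp⊩ (thm (ax⊥ A))

      dne⊩ : ∀ {A} → Hs ⊩ ¬ ¬ A → Hs ⊩ A
      dne⊩ {A} = mp⊩ (thm (axDNE A))

    □-mono : ∀ {Hs A B} → [] ⊩ A ⟶ B → Hs ⊩ □ A ⟶ □ B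
    □-mono {A = A} {B} p = closed⊩ (mp⊩ (thm (ax□K A B)) (nec⊩ [] p))

    excluded-middle : ∀ {Hs} A → Hs ⊩ A ∨ ¬ A
    excluded-middle A = closed⊩ (dne⊩ (deduction (mp⊩ h₀ (inr⊩ A (deduction (mp⊩ h₁ (inl⊩ (¬ A) h₀)))))))

    -- If □A fails, then ◇¬A holds; axiom 5 makes it necessary, and ◇¬A refutes □A.
    erased-H : (A : Fm ∗ Δ n) → Γ ⊢ fml (□ (□ A ∨ □ (□ A ⟶ □ ⊥c)))
    erased-H A = sound (case⊩ boxed-case unboxed-case (excluded-middle (□ A)))
      where
      X : Fm ∗ Δ n
      X = □ A ∨ □ (□ A ⟶ □ ⊥c)
      boxed-case : [] ⊩ □ A ⟶ □ X
      boxed-case = deduction (nec⊩ (boxed A ∷ []) (inl⊩ _ h₀))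
      ¬□A⇒◇¬A : [] ⊩ ¬ □ A ⟶ ◇ ¬ A
      ¬□A⇒◇¬A = deduction (deduction (mp⊩ h₁ (mp⊩ (□-mono (thm (axDNE A))) h₀)))
      □◇¬A⇒□¬□A : [] ⊩ □ ◇ ¬ A ⟶ □ (□ A ⟶ □ ⊥c)
      □◇¬A⇒□¬□A = □-mono (deduction (deduction
                  (exfalso⊩ (□ ⊥c) (mp⊩ h₁ (mp⊩ (□-mono (deduction (deduction (mp⊩ h₀ h₁)))) h₀)))))
      unboxed-case : [] ⊩ ¬ □ A ⟶ □ X
      unboxed-case = thm (⟶-trans (⟶-trans (sound ¬□A⇒◇¬A) (ax5 (¬ A)))
                                  (⟶-trans (sound □◇¬A⇒□¬□A) (sound (deduction (nec⊩ (boxed _ ∷ []) (inr⊩ _ h₀))))))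

    erased-K : (A B : Fm ∗ Δ n) → Γ ⊢ fml (□ (□ A ⟶ □ (□ B ⟶ □ A)))
    erased-K A B = sound (nec⊩ [] (deduction (nec⊩ (boxed A ∷ []) (deduction h₁))))

    erased-S : (A B C : Fm ∗ Δ n) →
               Γ ⊢ fml (□ (□ (□ A ⟶ □ (□ B ⟶ □ C)) ⟶ □ (□ (□ A ⟶ □ B) ⟶ □ (□ A ⟶ □ C))))
    erased-S A B C = sound (nec⊩ [] (deduction (nec⊩ (boxed _ ∷ []) (deduction (nec⊩ (boxed _ ∷ boxed _ ∷ [])
                       (deduction (mp⊩ (T⊩ (mp⊩ (T⊩ h₂) h₀)) (mp⊩ (T⊩ h₁) h₀))))))))

    erased-∧₁ : (A B : Fm ∗ Δ n) → Γ ⊢ fml (□ (□ (□ A ∧ □ B) ⟶ □ A))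
    erased-∧₁ A B = sound (nec⊩ [] (deduction (fst⊩ (T⊩ h₀))))

    erased-∧₂ : (A B : Fm ∗ Δ n) → Γ ⊢ fml (□ (□ (□ A ∧ □ B) ⟶ □ B))
    erased-∧₂ A B = sound (nec⊩ [] (deduction (snd⊩ (T⊩ h₀))))

    erased-∧I : (A B : Fm ∗ Δ n) → Γ ⊢ fml (□ (□ A ⟶ □ (□ B ⟶ □ (□ A ∧ □ B))))
    erased-∧I A B = sound (nec⊩ [] (deduction (nec⊩ (boxed A ∷ [])
                      (deduction (nec⊩ (boxed B ∷ boxed A ∷ []) (pair⊩ h₁ h₀))))))

    erased-∨₁ : (A B : Fm ∗ Δ n) → Γ ⊢ fml (□ (□ A ⟶ □ (□ A ∨ □ B)))
    erased-∨₁ A B = sound (nec⊩ [] (deduction (nec⊩ (boxed A ∷ []) (inl⊩ _ h₀))))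

    erased-∨₂ : (A B : Fm ∗ Δ n) → Γ ⊢ fml (□ (□ B ⟶ □ (□ A ∨ □ B)))
    erased-∨₂ A B = sound (nec⊩ [] (deduction (nec⊩ (boxed B ∷ []) (inr⊩ _ h₀))))

    erased-∨E : (A B C : Fm ∗ Δ n) →
                Γ ⊢ fml (□ (□ (□ A ⟶ □ C) ⟶ □ (□ (□ B ⟶ □ C) ⟶ □ (□ (□ A ∨ □ B) ⟶ □ C))))
    erased-∨E A B C = sound (nec⊩ [] (deduction (nec⊩ (boxed _ ∷ []) (deduction (nec⊩ (boxed _ ∷ boxed _ ∷ [])
                        (deduction (case⊩ (T⊩ h₂) (T⊩ h₁) (T⊩ h₀))))))))

    erased-⊥ : (A : Fm ∗ Δ n) → Γ ⊢ fml (□ (□ ⊥c ⟶ □ A))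
    erased-⊥ A = sound (nec⊩ [] (deduction (exfalso⊩ _ (T⊩ h₀))))

    erased-∀E : (φ : Fm ∗ Δ (suc n)) (y : Fin n) → Γ ⊢ fml (□ (□ All (□ φ) ⟶ □ ren (sub0 y) φ))
    erased-∀E φ y = sound (nec⊩ [] (deduction (mp⊩ (thm (ax∀E (□ φ) y)) (T⊩ h₀))))

    erased-∃I : (φ : Fm ∗ Δ (suc n)) (y : Fin n) → Γ ⊢ fml (□ (□ ren (sub0 y) φ ⟶ □ Ex (□ φ)))
    erased-∃I φ y = sound (nec⊩ [] (deduction (nec⊩ (boxed _ ∷ []) (mp⊩ (thm (ax∃I (□ φ) y)) h₀))))

    erased-?∧ : (A B : Fm ∗ Δ n) → Γ ⊢ fml ((□ (□ A ∧ □ B) ⟶ (□ A ∧ □ B)) ∧ ((□ A ∧ □ B) ⟶ □ (□ A ∧ □ B)))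
    erased-?∧ A B = sound (pair⊩ (thm (axT _))
      (deduction (mp⊩ (mp⊩ (closed⊩ (deduction (deduction (nec⊩ (boxed B ∷ boxed A ∷ []) (pair⊩ h₁ h₀)))))
                            (fst⊩ h₀)) (snd⊩ h₀))))

    erased-?∨ : (A B : Fm ∗ Δ n) → Γ ⊢ fml ((□ (□ A ∨ □ B) ⟶ (□ A ∨ □ B)) ∧ ((□ A ∨ □ B) ⟶ □ (□ A ∨ □ B)))
    erased-?∨ A B = sound (pair⊩ (thm (axT _))
      (deduction (case⊩ (closed⊩ (deduction (nec⊩ (boxed A ∷ []) (inl⊩ _ h₀))))
                        (closed⊩ (deduction (nec⊩ (boxed B ∷ []) (inr⊩ _ h₀)))) h₀)))

    erased-4 : (A : Fm ∗ Δ n) → Γ ⊢ fml (□ (□ A ⟶ □ □ A))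
    erased-4 A = sound (nec⊩ [] (deduction (nec⊩ (boxed A ∷ []) h₀)))

    erased-!K : (A B : Fm ∗ Δ n) → Γ ⊢ fml (□ (□ (A ⟶ B) ⟶ □ (□ A ⟶ □ B)))
    erased-!K A B = sound (nec⊩ [] (deduction (nec⊩ (boxed _ ∷ []) (deduction (nec⊩ (boxed A ∷ boxed _ ∷ [])
                      (mp⊩ (T⊩ h₁) (T⊩ h₀)))))))

  module _ {Δ n} {Γ : List (MF Δ n)} (D : Γ ∋ lift₀ D-QS5) where
    open Theory D
    private
      D↑ : lmap wk¹ Γ ∋ lift₀ D-QS5
      D↑ = map-∋ wk¹ D

      module Shifted = Theory D↑

      instantiate-fresh : ∀ {A : Fm ∗ Δ (suc n)} → Γ ∋ ∀¹ (fml A) → lmap wk¹ Γ ⊢ fml A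
      instantiate-fresh {A} p = subst (λ a → _ ⊢ fml a) (ren-sub0-liftF A) (∀¹E (hyp (map-∋ wk¹ p)) zero)

    erased-?∃ : (φ : Fm ∗ Δ (suc n)) → Γ ⊢ fml ((□ Ex (□ φ) ⟶ Ex (□ φ)) ∧ (Ex (□ φ) ⟶ □ Ex (□ φ)))
    erased-?∃ φ = sound (pair⊩ (thm (axT _)) (thm (exR (∀¹I ∃I-boxed))))
      where
      ∃I-boxed : lmap wk¹ Γ ⊢ fml (□ φ ⟶ □ Ex (□ ren (liftF suc) φ))
      ∃I-boxed = subst (λ a → lmap wk¹ Γ ⊢ fml (a ⟶ □ Ex (□ ren (liftF suc) φ))) (ren-sub0-liftF (□ φ))
        (Shifted.sound (Shifted.deduction (Shifted.nec⊩ (Shifted.boxed _ ∷ [])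
          (Shifted.mp⊩ (Shifted.thm (Shifted.ax∃I (□ ren (liftF suc) φ) zero)) Shifted.h₀))))

    erased-mp : {A B : Fm ∗ Δ n} → Γ ⊢ fml (□ A) → Γ ⊢ fml (□ (□ A ⟶ □ B)) → Γ ⊢ fml (□ B)
    erased-mp a ab = mp (mp (axT _) ab) a

    erased-gen : {P : Fm ∗ Δ n} {φ : Fm ∗ Δ (suc n)} →
                 Γ ∋ ∀¹ (fml (□ (□ ren suc P ⟶ □ φ))) → Γ ⊢ fml (□ (□ P ⟶ □ All (□ φ)))
    erased-gen {P} p = sound (nec⊩ [] (deduction (nec⊩ (boxed P ∷ [])
      (mp⊩ (thm (genR (∀¹I (Shifted.mp (Shifted.axT _) (instantiate-fresh p))))) h₀))))

    erased-ex : {P : Fm ∗ Δ n} {φ : Fm ∗ Δ (suc n)} →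
                Γ ∋ ∀¹ (fml (□ (□ φ ⟶ □ ren suc P))) → Γ ⊢ fml (□ (□ Ex (□ φ) ⟶ □ P))
    erased-ex p = sound (nec⊩ [] (deduction
      (mp⊩ (thm (exR (∀¹I (Shifted.mp (Shifted.axT _) (instantiate-fresh p))))) (T⊩ h₀))))

  erasedAxioms : [] ⊢ D-QS5 ⇛ Erasure.translateM QHC.D-QHCH
  erasedAxioms = ⇛I (bigAnd-intro {M = translateM QHC.Hprinciple}
                                  {Ms = lmap translateM (QHC.QCpart QHC.++' (QHC.QHpart QHC.++' QHC.QHCspecific))}
                                  (∀²I (erased-H here (v #0))) (++⁺ erased-QC (++⁺ erased-QH erased-QHC)))
    where
    open Erasure using (translateM)
    open Theory using (axT; nec; mp; ax⊤; ⟶-refl; erased-H; erased-K; erased-S; erased-∧₁; erased-∧₂; erased-∧I;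
                       erased-∨₁; erased-∨₂; erased-∨E; erased-⊥; erased-∀E; erased-∃I; erased-?∧; erased-?∨;
                       erased-4; erased-!K)
    Γ₀ : List (MF [] 0)
    Γ₀ = D-QS5 ∷ []
    erased-QC : All.All (Γ₀ ⊢_) (lmap translateM QHC.QCpart)
    erased-QC = ++⁻ˡ QCpart (tail (bigAnd-elim (principle [] 0 ⊤c) (QCpart ++' S5part) (hyp here)))
    erased-QH : All.All (Γ₀ ⊢_) (lmap translateM QHC.QHpart)
    erased-QH = ∀²I (∀²I (erased-K here (v #0) (v #1)))
              ∷ ∀²I (∀²I (∀²I (erased-S here (v #0) (v #1) (v #2))))
              ∷ ∀²I (∀²I (erased-∧₁ here (v #0) (v #1)))
              ∷ ∀²I (∀²I (erased-∧₂ here (v #0) (v #1)))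
              ∷ ∀²I (∀²I (erased-∧I here (v #0) (v #1)))
              ∷ ∀²I (∀²I (erased-∨₁ here (v #0) (v #1)))
              ∷ ∀²I (∀²I (erased-∨₂ here (v #0) (v #1)))
              ∷ ∀²I (∀²I (∀²I (erased-∨E here (v #0) (v #1) (v #2))))
              ∷ ∀²I (erased-⊥ here (v #0))
              ∷ nec here (ax⊤ here)
              ∷ ∀²I (∀¹I (erased-∀E here (u #0 zero) zero))
              ∷ ∀²I (∀¹I (erased-∃I here (u #0 zero) zero))
              ∷ ∀²I (∀²I (⇛I (erased-mp (there here) (&E₁ (hyp here)) (&E₂ (hyp here)))))
              ∷ ∀²I (∀²I (⇛I (erased-gen (there here) {P = v #0} here)))
              ∷ ∀²I (∀²I (⇛I (erased-ex (there here) {P = v #0} here)))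
              ∷ []
    erased-QHC : All.All (Γ₀ ⊢_) (lmap translateM QHC.QHCspecific)
    erased-QHC = ∀²I (∀²I (erased-?∧ here (v #0) (v #1)))
               ∷ ∀²I (∀²I (erased-?∨ here (v #0) (v #1)))
               ∷ ∀²I (∀²I (axT here _))
               ∷ axT here _
               ∷ ∀²I (erased-?∃ here (u #0 zero))
               ∷ ∀²I (axT here _)
               ∷ ∀²I (erased-4 here (v #0))
               ∷ nec here (⟶-refl here _)
               ∷ ∀²I (axT here _)
               ∷ ∀²I (erased-4 here (v #0))
               ∷ ∀²I (∀²I (erased-!K here (v #0) (v #1)))
               ∷ ∀²I (⇛I (mp (there here) (axT (there here) _) (hyp here)))
               ∷ ∀²I (⇛I (nec (there here) (hyp here)))
               ∷ []

module QHCReasoning where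

  open QHC
  open Meta syn
  open Lawful QHCLaws.laws

  module Theory {Δ n} {Γ : List (MF Δ n)} (D : Γ ∋ lift₀ D-QHCH) where

    -- Axiom 0 of D-QHCH is H, 1–16 are the QC axioms, 17–31 the QH axioms and 32–44 the
    -- specific principles and rules of QHC.
    axiom : (i : Fin 45) → Γ ⊢ lift₀ (lookupL (Hprinciple ∷ QCpart ++' (QHpart ++' QHCspecific)) i)
    axiom i = conjunct {M = Hprinciple} {QCpart ++' (QHpart ++' QHCspecific)} i (hyp D)

    axH : (A : Fm int Δ n) → Γ ⊢ fml (⁇ (A ∨ ¬ A))
    axH A = schema₁ (λ a → fml (⁇ (a ∨ ¬ a))) (∀²E′ (axiom (# 0)) A)

    axK : ∀ s (A B : Fm s Δ n) → Γ ⊢ fml (A ⟶ (B ⟶ A))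
    axK cl  A B = schema₂ (λ a b → fml (a ⟶ (b ⟶ a))) (∀²E₂ (axiom (# 2)) A B)
    axK int A B = schema₂ (λ a b → fml (a ⟶ (b ⟶ a))) (∀²E₂ (axiom (# 17)) A B)

    axS : ∀ s (A B C : Fm s Δ n) → Γ ⊢ fml ((A ⟶ (B ⟶ C)) ⟶ ((A ⟶ B) ⟶ (A ⟶ C)))
    axS cl  A B C = schema₃ (λ a b c → fml ((a ⟶ (b ⟶ c)) ⟶ ((a ⟶ b) ⟶ (a ⟶ c)))) (∀²E₃ (axiom (# 3)) A B C)
    axS int A B C = schema₃ (λ a b c → fml ((a ⟶ (b ⟶ c)) ⟶ ((a ⟶ b) ⟶ (a ⟶ c)))) (∀²E₃ (axiom (# 18)) A B C)

    mp : ∀ s {A B : Fm s Δ n} → Γ ⊢ fml (A ⟶ B) → Γ ⊢ fml A → Γ ⊢ fml B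
    mp cl  {A} {B} ab a = ⇛E (schema₂ (λ a b → (fml a & fml (a ⟶ b)) ⇛ fml b) (∀²E₂ (axiom (# 14)) A B)) (&I a ab)
    mp int {A} {B} ab a = ⇛E (schema₂ (λ a b → (fml a & fml (a ⟶ b)) ⇛ fml b) (∀²E₂ (axiom (# 29)) A B)) (&I a ab)

    ax∧₁ : (A B : Fm cl Δ n) → Γ ⊢ fml ((A ∧ B) ⟶ A)
    ax∧₁ A B = schema₂ (λ a b → fml ((a ∧ b) ⟶ a)) (∀²E₂ (axiom (# 4)) A B)

    ax∨E : (A B C : Fm cl Δ n) → Γ ⊢ fml ((A ⟶ C) ⟶ ((B ⟶ C) ⟶ ((A ∨ B) ⟶ C)))
    ax∨E A B C = schema₃ (λ a b c → fml ((a ⟶ c) ⟶ ((b ⟶ c) ⟶ ((a ∨ b) ⟶ c)))) (∀²E₃ (axiom (# 9)) A B C)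

    ax⊥ : (A : Fm cl Δ n) → Γ ⊢ fml (⊥c ⟶ A)
    ax⊥ A = schema₁ (λ a → fml (⊥c ⟶ a)) (∀²E′ (axiom (# 10)) A)

    ax?∨ : (A B : Fm int Δ n) → Γ ⊢ fml (⁇ (A ∨ B) ↔ (⁇ A) ∨ (⁇ B))
    ax?∨ A B = schema₂ (λ a b → fml (⁇ (a ∨ b) ↔ (⁇ a) ∨ (⁇ b))) (∀²E₂ (axiom (# 33)) A B)

    ax?K : (A B : Fm int Δ n) → Γ ⊢ fml (⁇ (A ⟶ B) ⟶ (⁇ A ⟶ ⁇ B))
    ax?K A B = schema₂ (λ a b → fml (⁇ (a ⟶ b) ⟶ (⁇ a ⟶ ⁇ b))) (∀²E₂ (axiom (# 34)) A B)

    ax¬?⋏ : Γ ⊢ fml (¬ (⁇ ⋏))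
    ax¬?⋏ = axiom (# 35)

    ax!? : (A : Fm int Δ n) → Γ ⊢ fml (A ⟶ ! ⁇ A)
    ax!? A = schema₁ (λ a → fml (a ⟶ ! ⁇ a)) (∀²E′ (axiom (# 38)) A)

    ax?! : (A : Fm cl Δ n) → Γ ⊢ fml (⁇ ! A ⟶ A)
    ax?! A = schema₁ (λ a → fml (⁇ ! a ⟶ a)) (∀²E′ (axiom (# 40)) A)

    ax!?! : (A : Fm cl Δ n) → Γ ⊢ fml (! A ⟶ ! ⁇ ! A)
    ax!?! A = schema₁ (λ a → fml (! a ⟶ ! ⁇ ! a)) (∀²E′ (axiom (# 41)) A)

    ax!K : (A B : Fm cl Δ n) → Γ ⊢ fml (! (A ⟶ B) ⟶ (! A ⟶ ! B))
    ax!K A B = schema₂ (λ a b → fml (! (a ⟶ b) ⟶ (! a ⟶ ! b))) (∀²E₂ (axiom (# 42)) A B)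

    unbang : {A : Fm cl Δ n} → Γ ⊢ fml (! A) → Γ ⊢ fml A
    unbang {A} = ⇛E (schema₁ (λ a → fml (! a) ⇛ fml a) (∀²E′ (axiom (# 43)) A))

    bang : {A : Fm cl Δ n} → Γ ⊢ fml A → Γ ⊢ fml (! A)
    bang {A} = ⇛E (schema₁ (λ a → fml a ⇛ fml (! a)) (∀²E′ (axiom (# 44)) A))

    module Classical = Implication _⟶_ (λ A → Γ ⊢ fml A) (mp cl) (axK cl) (axS cl)
    module Intuitionistic = Implication _⟶_ (λ A → Γ ⊢ fml A) (mp int) (axK int) (axS int)

    ⁇-nec : {A : Fm int Δ n} → Γ ⊢ fml A → Γ ⊢ fml (⁇ A)
    ⁇-nec {A} p = unbang (mp int (ax!? A) p)

    ?!-nec : {A : Fm cl Δ n} → Γ ⊢ fml A → Γ ⊢ fml (⁇ ! A)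
    ?!-nec = ⁇-nec ∘ bang

    ?!-K : (A B : Fm cl Δ n) → Γ ⊢ fml (⁇ ! (A ⟶ B) ⟶ (⁇ ! A ⟶ ⁇ ! B))
    ?!-K A B = Classical.⟶-trans (mp cl (ax?K (! (A ⟶ B)) (! A ⟶ ! B)) (⁇-nec (ax!K A B))) (ax?K (! A) (! B))

    ?!-4 : (A : Fm cl Δ n) → Γ ⊢ fml (⁇ ! A ⟶ ⁇ ! ⁇ ! A)
    ?!-4 A = mp cl (ax?K (! A) (! ⁇ ! A)) (⁇-nec (ax!?! A))

    open BoxedDeduction _⟶_ (⁇_ ∘ !_) (λ A → Γ ⊢ fml A) (mp cl) (axK cl) (axS cl) ?!-nec ?!-K ?!-4
      using (_⊩_; hyp; mp⊩; thm; sound; deduction)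

    -- H splits ?N ∨ ?¬N for N = !¬A: the first case contradicts ¬?N, and in the second
    -- ¬N yields !¬?N by the axioms γ → !?γ and ¬?⋏.
    ?!-5 : (A : Fm cl Δ n) → Γ ⊢ fml (¬ ⁇ ! ¬ A ⟶ ⁇ ! ¬ ⁇ ! ¬ A)
    ?!-5 A = sound (deduction (case (deduction (exfalso (mp⊩ (hyp (there here)) (hyp here))))
                                     (thm ?¬N⇒G) (thm ?N∨?¬N)))
      where
      N : Fm int Δ n
      N = ! ¬ A
      G : Fm cl Δ n
      G = ⁇ ! ¬ ⁇ N
      case : ∀ {Hs} {X Y Z : Fm cl Δ n} → Hs ⊩ X ⟶ Z → Hs ⊩ Y ⟶ Z → Hs ⊩ X ∨ Y → Hs ⊩ Z
      case {X = X} {Y} {Z} f g p = mp⊩ (mp⊩ (mp⊩ (thm (ax∨E X Y Z)) f) g) p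
      exfalso : ∀ {Hs} → Hs ⊩ ⊥c → Hs ⊩ G
      exfalso = mp⊩ (thm (ax⊥ G))
      ?N∨?¬N : Γ ⊢ fml (⁇ N ∨ ⁇ ¬ N)
      ?N∨?¬N = mp cl (mp cl (ax∧₁ _ _) (ax?∨ N (¬ N))) (axH N)
      ?¬N⇒¬?N : Γ ⊢ fml (⁇ ¬ N ⟶ ¬ ⁇ N)
      ?¬N⇒¬?N = sound (deduction (deduction
                  (mp⊩ (thm ax¬?⋏) (mp⊩ (mp⊩ (thm (ax?K N ⋏)) (hyp (there here))) (hyp here)))))
      ¬N⇒!¬?N : Γ ⊢ fml (¬ N ⟶ ! ¬ ⁇ N)
      ¬N⇒!¬?N = Intuitionistic.⟶-trans (ax!? (¬ N)) (mp int (ax!K (⁇ ¬ N) (¬ ⁇ N)) (bang ?¬N⇒¬?N))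
      ?¬N⇒G : Γ ⊢ fml (⁇ ¬ N ⟶ G)
      ?¬N⇒G = mp cl (ax?K (¬ N) (! ¬ ⁇ N)) (⁇-nec ¬N⇒!¬?N)

  embeddedAxioms : [] ⊢ D-QHCH ⇛ Embedding.translateM QS5.D-QS5
  embeddedAxioms = ⇛I (bigAnd-intro {M = translateM (QS5.principle [] 0 QS5.⊤c)}
                                    {Ms = lmap translateM (QS5.QCpart QS5.++' QS5.S5part)}
                                    (axiom here (# 11)) (++⁺ embedded-QC embedded-S5))
    where
    open Embedding using (translateM)
    open Theory using (axiom; ax?!; ?!-nec; ?!-K; ?!-4; ?!-5)
    embedded-QC : All.All ((D-QHCH ∷ []) ⊢_) (lmap translateM QS5.QCpart)
    embedded-QC = ++⁻ˡ QCpart (tail (bigAnd-elim Hprinciple (QCpart ++' (QHpart ++' QHCspecific)) (hyp here)))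
    embedded-S5 : All.All ((D-QHCH ∷ []) ⊢_) (lmap translateM QS5.S5part)
    embedded-S5 = ∀²I (ax?! here (v #0))
                ∷ ∀²I (?!-4 here (v #0))
                ∷ ∀²I (∀²I (?!-K here (v #0) (v #1)))
                ∷ ∀²I (?!-5 here (v #0))
                ∷ ∀²I (⇛I (?!-nec (there here) (hyp here)))
                ∷ []

mainTheorem13 : (R : QS5.MF [] 0) → QS5.RuleOrPrinciple R →
    (QHC.Derivable QHC.D-QHCH (Translation.trM R) ⇔ QS5.Derivable QS5.D-QS5 R)
mainTheorem13 R _ = mk⇔ reflect embed
  where
  reflect : QHC.Derivable QHC.D-QHCH (Translation.trM R) → QS5.Derivable QS5.D-QS5 R
  reflect d = subst (QS5.Derivable QS5.D-QS5) (Erasure.translateM∘trM-closed R)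
                    (Meta.⇛-trans QS5.syn QS5Reasoning.erasedAxioms (Erasure.translate⊢ d))
  embed : QS5.Derivable QS5.D-QS5 R → QHC.Derivable QHC.D-QHCH (Translation.trM R)
  embed d = subst (QHC.Derivable QHC.D-QHCH) (Embedding.translateM≡trM R)
                  (Meta.⇛-trans QHC.syn QHCReasoning.embeddedAxioms (Embedding.translate⊢ d))
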